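{- Let $4.2$ denote the $3$-graph on $4$ vertices with exactly $2$ edges (unique up to isomorphism). Then $\pi_{4.2}(\emptyset)=3/4$; that is, the limit as $n\to\infty$ of the maximum, over all $3$-graphs $G$ on $n$ vertices, of the number of $4$-element vertex subsets of $G$ spanning exactly two edges, divided by $\binom{n}{4}$, equals $3/4$.
   Context: A $3$-graph is a pair $G=(V,E)$ with $E$ a set of $3$-element subsets of $V$. For a $3$-graph $H$ on $h$ vertices and a $3$-graph $G$ on $n\ge h$ vertices, $e_H(G)$ is the number of $h$-subsets of $V(G)$ inducing a copy of $H$. $\pi_H(\emptyset)=\lim_{n\to\infty}\max\{e_H(G): |V(G)|=n\}/\binom{n}{h}$ (the inducibility of $H$; the limit exists). -}

module Defs where

open import Data.Nat using (ℕ; zero; suc; _≡ᵇ_)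
open import Data.Bool using (Bool; true; false; _∧_)
open import Data.List using (List; []; _∷_; map; _++_; filter; length)
open import Data.Vec using (_∷_; [])
open import Data.Fin.Subset using (Subset; inside; outside; ∣_∣; _⊆_)
open import Data.Fin.Subset.Properties using (_⊆?_)
open import Relation.Nullary.Decidable using (⌊_⌋)
open import Relation.Binary.PropositionalEquality using (_≡_)
open import Relation.Unary using (Decidable)

allSubsets : (n : ℕ) → List (Subset n)
allSubsets zero = [] ∷ []
allSubsets (suc n) = map (outside ∷_) (allSubsets n) ++ map (inside ∷_) (allSubsets n)

kSubsets : (n k : ℕ) → List (Subset n)
kSubsets n k = filter (λ S → Data.Nat._≟_ ∣ S ∣ k) (allSubsets n)

-- A 3-graph on vertex set Fin n: the edge set is the set of 3-element
-- subsets T of Fin n with isEdge T ≡ true (values on subsets of other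
-- sizes are irrelevant).
record ThreeGraph (n : ℕ) : Set where
  field
    isEdge : Subset n → Bool
open ThreeGraph public

edgesIn : {n : ℕ} → ThreeGraph n → Subset n → ℕ
edgesIn {n} G S =
  length (filter (λ T → T ⊆? S) (filter (λ T → isEdge G T Data.Bool.≟ true) (kSubsets n 3)))

e42 : {n : ℕ} → ThreeGraph n → ℕ
e42 {n} G = length (filter (λ S → Data.Nat._≟_ (edgesIn G S) 2) (kSubsets n 4))

-- A 4-set with e edges contains 2e(4 − e) ordered pairs of triples of different edge status, which
-- is 8 when e = 2, and two distinct triples lie in a common 4-set iff they share a pair X. Counting these pairs of
-- triples through the pairs X gives 8 e₄.₂(G) ≤ ∑_X 2 c_X (n − 2 − c_X) ≤ (n − 2)² C(n,2) / 2, where c_X is the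
-- codegree of X; this is (3/4 + o(1)) C(n,4).
--
-- Label the vertices by k-bit strings and make a triple an edge iff the GF(2)-sum of the inner
-- products of the labels of its three pairs is 1. Every pair lies in two triples of a 4-set, so each 4-set spans
-- 0, 2 or 4 edges and the first inequality above is an equality. For a pair X with distinct labels, whether z
-- completes X to an edge is a non-constant affine function of the label of z, so c_X ≈ (n − 2)/2; only the
-- O(n² / 2ᵏ) pairs with equal labels escape this. Taking 2ᵏ ≥ 4/ε and n large gives e₄.₂(G) ≥ (3/4 − ε) C(n,4).

module Submission where

open import Defs
open import Data.Nat using (ℕ; _≥_)
open import Data.Nat.Combinatorics using (_C_)
open import Data.Integer using (+_)
open import Data.Rational using (ℚ; _/_; _+_; _-_; _*_; _≤_; _<_; 0ℚ)
open import Data.Product using (Σ; _×_; ∃)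

open import Data.Nat as ℕ using (zero; suc; _∸_; _^_; _≡ᵇ_; z≤n; s≤s)
open import Data.Nat.Properties
open import Data.Nat.Combinatorics using (nC1≡n; nCk+nC[k+1]≡[n+1]C[k+1])
open import Data.Nat.Tactic.RingSolver using (solve-∀)
open import Data.Bool as Bool using (Bool; true; false; _∧_; _∨_; not; _xor_)
open import Data.Bool.Properties as BoolP
  using (∧-zeroʳ; ∧-identityʳ; ∧-comm; ∧-assoc; xor-same; xor-assoc; T-≡)
open import Data.Vec using ([]; _∷_; lookup; tabulate)
open import Data.Vec.Properties using (lookup∘tabulate)
open import Data.Fin as Fin using (Fin; toℕ)
open import Data.Fin.Subset
  using (Subset; inside; outside; ∣_∣; _⊆_; _∪_; _∩_; ⁅_⁆) renaming (⊥ to ∅; ⊤ to full)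
open import Data.Fin.Subset.Properties
  using (_⊆?_; ⊆-trans; ⊆⊤; ⊥⊆; p⊆q⇒∣p∣≤∣q∣; ∣⊤∣≡n; ∣⊥∣≡0; ∣p∩q∣≤∣p∣; ∣p∩q∣≤∣q∣; ∣⁅x⁆∣≡1; ∪-identityʳ; ∩-zeroˡ)
open import Data.List as List using (List; []; _∷_; _++_; map; filter; length)
open import Data.Product using (_,_; proj₁; proj₂)
open import Data.Sum using (_⊎_; inj₁; inj₂; [_,_]′)
open import Data.Empty using (⊥-elim)
open import Function using (case_of_; _⟨_⟩_; id)
open import Data.List.Properties using (length-tabulate)
open import Function.Bundles using (Equivalence)
open import Relation.Nullary using (Dec; does; yes)
open import Relation.Nullary.Decidable using (dec-true)
open import Relation.Binary.PropositionalEquality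
import Data.Integer as ℤ
open import Data.Integer using (ℤ)
import Data.Integer.Properties as ℤP
open import Data.Integer.Tactic.RingSolver using () renaming (solve-∀ to ℤ-solve-∀)
import Data.Rational as ℚ
open import Data.Rational.Properties
  using (normalize-coprime; toℚᵘ-cancel-≤; toℚᵘ-homo-*; toℚᵘ-homo-+; toℚᵘ-homo‿-)
import Data.Rational.Unnormalised as ℚᵘ
import Data.Rational.Unnormalised.Properties as ℚᵘP
open import Data.Nat.Coprimality as Coprime using (Coprime; 1-coprimeTo)

-- Finite sums

𝟙 : Bool → ℕ
𝟙 true = 1
𝟙 false = 0

∑ : {A : Set} → List A → (A → ℕ) → ℕ
∑ [] f = 0
∑ (x ∷ xs) f = f x ℕ.+ ∑ xs f

module _ {A : Set} where

  ∑-cong : (xs : List A) {f g : A → ℕ} → (∀ x → f x ≡ g x) → ∑ xs f ≡ ∑ xs g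
  ∑-cong [] eq = refl
  ∑-cong (x ∷ xs) eq = cong₂ ℕ._+_ (eq x) (∑-cong xs eq)

  ∑-mono-≤ : (xs : List A) {f g : A → ℕ} → (∀ x → f x ℕ.≤ g x) → ∑ xs f ℕ.≤ ∑ xs g
  ∑-mono-≤ [] le = z≤n
  ∑-mono-≤ (x ∷ xs) le = +-mono-≤ (le x) (∑-mono-≤ xs le)

  ∑-zero : (xs : List A) {f : A → ℕ} → (∀ x → f x ≡ 0) → ∑ xs f ≡ 0
  ∑-zero [] eq = refl
  ∑-zero (x ∷ xs) eq = cong₂ ℕ._+_ (eq x) (∑-zero xs eq)

  ∑-+ : (xs : List A) (f g : A → ℕ) → ∑ xs (λ x → f x ℕ.+ g x) ≡ ∑ xs f ℕ.+ ∑ xs g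
  ∑-+ [] f g = refl
  ∑-+ (x ∷ xs) f g rewrite ∑-+ xs f g = shuffle (f x) (g x) (∑ xs f) (∑ xs g)
    where
    shuffle : ∀ a b c d → a ℕ.+ b ℕ.+ (c ℕ.+ d) ≡ a ℕ.+ c ℕ.+ (b ℕ.+ d)
    shuffle = solve-∀

  ∑-*ˡ : (xs : List A) (c : ℕ) (f : A → ℕ) → ∑ xs (λ x → c ℕ.* f x) ≡ c ℕ.* ∑ xs f
  ∑-*ˡ [] c f = sym (*-zeroʳ c)
  ∑-*ˡ (x ∷ xs) c f rewrite ∑-*ˡ xs c f = sym (*-distribˡ-+ c (f x) (∑ xs f))

  ∑-*ʳ : (xs : List A) (c : ℕ) (f : A → ℕ) → ∑ xs (λ x → f x ℕ.* c) ≡ ∑ xs f ℕ.* c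
  ∑-*ʳ xs c f = trans (∑-cong xs (λ x → *-comm (f x) c)) (trans (∑-*ˡ xs c f) (*-comm c _))

  ∑-const : (xs : List A) (c : ℕ) → ∑ xs (λ _ → c) ≡ c ℕ.* length xs
  ∑-const [] c = sym (*-zeroʳ c)
  ∑-const (x ∷ xs) c rewrite ∑-const xs c = sym (*-suc c (length xs))

  ∑-++ : (xs ys : List A) (f : A → ℕ) → ∑ (xs ++ ys) f ≡ ∑ xs f ℕ.+ ∑ ys f
  ∑-++ [] ys f = refl
  ∑-++ (x ∷ xs) ys f rewrite ∑-++ xs ys f = sym (+-assoc (f x) (∑ xs f) (∑ ys f))

  ∑-filter : {P : A → Set} (P? : (x : A) → Dec (P x)) (xs : List A) (f : A → ℕ) →
    ∑ (filter P? xs) f ≡ ∑ xs (λ x → 𝟙 (does (P? x)) ℕ.* f x)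
  ∑-filter P? [] f = refl
  ∑-filter P? (x ∷ xs) f with does (P? x)
  ... | true = cong₂ ℕ._+_ (sym (+-identityʳ (f x))) (∑-filter P? xs f)
  ... | false = ∑-filter P? xs f

  length≡∑1 : (xs : List A) → length xs ≡ ∑ xs (λ _ → 1)
  length≡∑1 [] = refl
  length≡∑1 (x ∷ xs) = cong suc (length≡∑1 xs)

  ∑-product : (xs : List A) (f g : A → ℕ) →
    ∑ xs (λ x → ∑ xs (λ y → f x ℕ.* g y)) ≡ ∑ xs f ℕ.* ∑ xs g
  ∑-product xs f g = trans (∑-cong xs (λ x → ∑-*ˡ xs (f x) g)) (∑-*ʳ xs (∑ xs g) f)

∑-map : {A B : Set} (g : A → B) (xs : List A) (f : B → ℕ) → ∑ (map g xs) f ≡ ∑ xs (λ x → f (g x))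
∑-map g [] f = refl
∑-map g (x ∷ xs) f = cong (f (g x) ℕ.+_) (∑-map g xs f)

∑-comm : {A B : Set} (xs : List A) (ys : List B) (f : A → B → ℕ) →
  ∑ xs (λ x → ∑ ys (λ y → f x y)) ≡ ∑ ys (λ y → ∑ xs (λ x → f x y))
∑-comm [] ys f = sym (∑-zero ys (λ _ → refl))
∑-comm (x ∷ xs) ys f rewrite ∑-comm xs ys f = sym (∑-+ ys (f x) (λ y → ∑ xs (λ x′ → f x′ y)))

𝟙-∧ : ∀ a b → 𝟙 (a ∧ b) ≡ 𝟙 a ℕ.* 𝟙 b
𝟙-∧ false b = refl
𝟙-∧ true b = sym (+-identityʳ (𝟙 b))

𝟙-partition : ∀ w b → 𝟙 (w ∧ b) ℕ.+ 𝟙 (w ∧ not b) ≡ 𝟙 w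
𝟙-partition false b = refl
𝟙-partition true false = refl
𝟙-partition true true = refl

∑-xor : {A : Set} (xs : List A) (w b : A → Bool) →
  ∑ xs (λ x → ∑ xs (λ y → 𝟙 ((w x ∧ w y) ∧ (b x xor b y)))) ≡
  2 ℕ.* (∑ xs (λ x → 𝟙 (w x ∧ b x)) ℕ.* ∑ xs (λ x → 𝟙 (w x ∧ not (b x))))
∑-xor {A} xs w b = begin
  ∑ xs (λ x → ∑ xs (λ y → 𝟙 ((w x ∧ w y) ∧ (b x xor b y))))
    ≡⟨ ∑-cong xs (λ x → trans (∑-cong xs (λ y → split (w x) (w y) (b x) (b y))) (∑-+ xs _ _)) ⟩
  ∑ xs (λ x → ∑ xs (λ y → f x ℕ.* g y) ℕ.+ ∑ xs (λ y → g x ℕ.* f y))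
    ≡⟨ ∑-+ xs _ _ ⟩
  ∑ xs (λ x → ∑ xs (λ y → f x ℕ.* g y)) ℕ.+ ∑ xs (λ x → ∑ xs (λ y → g x ℕ.* f y))
    ≡⟨ cong₂ ℕ._+_ (∑-product xs f g) (∑-product xs g f) ⟩
  ∑ xs f ℕ.* ∑ xs g ℕ.+ ∑ xs g ℕ.* ∑ xs f
    ≡⟨ twice (∑ xs f) (∑ xs g) ⟩
  2 ℕ.* (∑ xs f ℕ.* ∑ xs g) ∎
  where
  open ≡-Reasoning
  f g : A → ℕ
  f x = 𝟙 (w x ∧ b x)
  g x = 𝟙 (w x ∧ not (b x))
  split : ∀ wx wy bx by → 𝟙 ((wx ∧ wy) ∧ (bx xor by)) ≡
    𝟙 (wx ∧ bx) ℕ.* 𝟙 (wy ∧ not by) ℕ.+ 𝟙 (wx ∧ not bx) ℕ.* 𝟙 (wy ∧ by)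
  split false wy bx by = refl
  split true false bx by rewrite *-zeroʳ (𝟙 bx) | *-zeroʳ (𝟙 (not bx)) = refl
  split true true false false = refl
  split true true false true = refl
  split true true true false = refl
  split true true true true = refl
  twice : ∀ a b → a ℕ.* b ℕ.+ b ℕ.* a ≡ 2 ℕ.* (a ℕ.* b)
  twice = solve-∀

∑-partition : {A : Set} (xs : List A) (w b : A → Bool) →
  ∑ xs (λ x → 𝟙 (w x ∧ b x)) ℕ.+ ∑ xs (λ x → 𝟙 (w x ∧ not (b x))) ≡ ∑ xs (λ x → 𝟙 (w x))
∑-partition xs w b = trans (sym (∑-+ xs _ _)) (∑-cong xs (λ x → 𝟙-partition (w x) (b x)))

∑-tabulate : {A : Set} {n : ℕ} (f : Fin n → A) (h : A → ℕ) →
  ∑ (List.tabulate f) h ≡ ∑ (List.allFin n) (λ i → h (f i))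
∑-tabulate {n = zero} f h = refl
∑-tabulate {n = suc n} f h =
  cong (h (f Fin.zero) ℕ.+_) (trans (∑-tabulate (λ i → f (Fin.suc i)) h) (sym (∑-tabulate Fin.suc (λ i → h (f i)))))

∑-allFin-suc : (n : ℕ) (h : Fin (suc n) → ℕ) →
  ∑ (List.allFin (suc n)) h ≡ h Fin.zero ℕ.+ ∑ (List.allFin n) (λ i → h (Fin.suc i))
∑-allFin-suc n h = cong (h Fin.zero ℕ.+_) (∑-tabulate Fin.suc h)

∑-applyUpTo : {A : Set} (f : ℕ → A) (k : ℕ) (h : A → ℕ) →
  ∑ (List.applyUpTo f k) h ≡ ∑ (List.upTo k) (λ j → h (f j))
∑-applyUpTo f zero h = refl
∑-applyUpTo f (suc k) h =
  cong (h (f 0) ℕ.+_) (trans (∑-applyUpTo (λ j → f (suc j)) k h) (sym (∑-applyUpTo suc k (λ j → h (f j)))))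

∑-upTo-suc : (k : ℕ) (h : ℕ → ℕ) → ∑ (List.upTo (suc k)) h ≡ h 0 ℕ.+ ∑ (List.upTo k) (λ j → h (suc j))
∑-upTo-suc k h = cong (h 0 ℕ.+_) (∑-applyUpTo suc k h)

∑-upTo-snoc : (k : ℕ) (h : ℕ → ℕ) → ∑ (List.upTo (suc k)) h ≡ ∑ (List.upTo k) h ℕ.+ h k
∑-upTo-snoc zero h = +-comm (h 0) 0
∑-upTo-snoc (suc k) h = begin
  ∑ (List.upTo (suc (suc k))) h                              ≡⟨ ∑-upTo-suc (suc k) h ⟩
  h 0 ℕ.+ ∑ (List.upTo (suc k)) (λ j → h (suc j))            ≡⟨ cong (h 0 ℕ.+_) (∑-upTo-snoc k (λ j → h (suc j))) ⟩
  h 0 ℕ.+ (∑ (List.upTo k) (λ j → h (suc j)) ℕ.+ h (suc k))  ≡⟨ sym (+-assoc (h 0) _ _) ⟩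
  h 0 ℕ.+ ∑ (List.upTo k) (λ j → h (suc j)) ℕ.+ h (suc k)    ≡⟨ cong (ℕ._+ h (suc k)) (sym (∑-upTo-suc k h)) ⟩
  ∑ (List.upTo (suc k)) h ℕ.+ h (suc k)                      ∎
  where open ≡-Reasoning

∑-allFin-toℕ : (n : ℕ) (h : ℕ → ℕ) → ∑ (List.allFin n) (λ i → h (toℕ i)) ≡ ∑ (List.upTo n) h
∑-allFin-toℕ zero h = refl
∑-allFin-toℕ (suc n) h = begin
  ∑ (List.allFin (suc n)) (λ i → h (toℕ i))           ≡⟨ ∑-allFin-suc n (λ i → h (toℕ i)) ⟩
  h 0 ℕ.+ ∑ (List.allFin n) (λ i → h (suc (toℕ i)))   ≡⟨ cong (h 0 ℕ.+_) (∑-allFin-toℕ n (λ j → h (suc j))) ⟩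
  h 0 ℕ.+ ∑ (List.upTo n) (λ j → h (suc j))           ≡⟨ sym (∑-upTo-suc n h) ⟩
  ∑ (List.upTo (suc n)) h                             ∎
  where open ≡-Reasoning

-- Subsets of Fin n

infix 7 _⊆ᵇ_
_⊆ᵇ_ : {n : ℕ} → Subset n → Subset n → Bool
U ⊆ᵇ S = does (U ⊆? S)

infix 7 ∣_∣≡ᵇ_
∣_∣≡ᵇ_ : {n : ℕ} → Subset n → ℕ → Bool
∣ S ∣≡ᵇ k = ∣ S ∣ ≡ᵇ k

≡ᵇ-sound : ∀ a b → (a ≡ᵇ b) ≡ true → a ≡ b
≡ᵇ-sound a b h = ≡ᵇ⇒≡ a b (Equivalence.from T-≡ h)

∑ˢ : (n : ℕ) → (Subset n → ℕ) → ℕ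
∑ˢ n f = ∑ (allSubsets n) f

∑ˢ-suc : (n : ℕ) (f : Subset (suc n) → ℕ) →
  ∑ˢ (suc n) f ≡ ∑ˢ n (λ S → f (outside ∷ S)) ℕ.+ ∑ˢ n (λ S → f (inside ∷ S))
∑ˢ-suc n f = trans (∑-++ (map (outside ∷_) (allSubsets n)) (map (inside ∷_) (allSubsets n)) f)
  (cong₂ ℕ._+_ (∑-map (outside ∷_) (allSubsets n) f) (∑-map (inside ∷_) (allSubsets n) f))

∑ˢ-zero : (n : ℕ) {f : Subset n → ℕ} → (∀ S → f S ≡ 0) → ∑ˢ n f ≡ 0
∑ˢ-zero n = ∑-zero (allSubsets n)

∑ˢ-cong : (n : ℕ) {f g : Subset n → ℕ} → (∀ S → f S ≡ g S) → ∑ˢ n f ≡ ∑ˢ n g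
∑ˢ-cong n = ∑-cong (allSubsets n)

⊆ᵇ⇒⊆ : {n : ℕ} (U S : Subset n) → U ⊆ᵇ S ≡ true → U ⊆ S
⊆ᵇ⇒⊆ U S h with U ⊆? S | h
... | yes U⊆S | _ = U⊆S

⊆⇒⊆ᵇ : {n : ℕ} (U S : Subset n) → U ⊆ S → U ⊆ᵇ S ≡ true
⊆⇒⊆ᵇ U S = dec-true (U ⊆? S)

⊆ᵇ-trans : {n : ℕ} (U S V : Subset n) → U ⊆ᵇ S ≡ true → S ⊆ᵇ V ≡ true → U ⊆ᵇ V ≡ true
⊆ᵇ-trans U S V h₁ h₂ = ⊆⇒⊆ᵇ U V (⊆-trans (⊆ᵇ⇒⊆ U S h₁) (⊆ᵇ⇒⊆ S V h₂))

⊆ᵇ⇒∣∣≤ : {n : ℕ} (U S : Subset n) → U ⊆ᵇ S ≡ true → ∣ U ∣ ℕ.≤ ∣ S ∣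
⊆ᵇ⇒∣∣≤ U S h = p⊆q⇒∣p∣≤∣q∣ (⊆ᵇ⇒⊆ U S h)

⊆ᵇ-full : {n : ℕ} (S : Subset n) → S ⊆ᵇ full ≡ true
⊆ᵇ-full S = ⊆⇒⊆ᵇ S full ⊆⊤

∅-⊆ᵇ : {n : ℕ} (S : Subset n) → ∅ ⊆ᵇ S ≡ true
∅-⊆ᵇ S = ⊆⇒⊆ᵇ ∅ S ⊥⊆

∣S∣≤n : {n : ℕ} (S : Subset n) → ∣ S ∣ ℕ.≤ n
∣S∣≤n {n} S = subst (∣ S ∣ ℕ.≤_) (∣⊤∣≡n n) (⊆ᵇ⇒∣∣≤ S full (⊆ᵇ-full S))

∪-⊆ᵇ : {n : ℕ} (T T′ S : Subset n) → (T ∪ T′) ⊆ᵇ S ≡ (T ⊆ᵇ S ∧ T′ ⊆ᵇ S)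
∪-⊆ᵇ [] [] [] = refl
∪-⊆ᵇ (outside ∷ T) (outside ∷ T′) (s ∷ S) = ∪-⊆ᵇ T T′ S
∪-⊆ᵇ (outside ∷ T) (inside ∷ T′) (outside ∷ S) = sym (∧-zeroʳ _)
∪-⊆ᵇ (outside ∷ T) (inside ∷ T′) (inside ∷ S) = ∪-⊆ᵇ T T′ S
∪-⊆ᵇ (inside ∷ T) (t′ ∷ T′) (outside ∷ S) = refl
∪-⊆ᵇ (inside ∷ T) (outside ∷ T′) (inside ∷ S) = ∪-⊆ᵇ T T′ S
∪-⊆ᵇ (inside ∷ T) (inside ∷ T′) (inside ∷ S) = ∪-⊆ᵇ T T′ S

⊆ᵇ-∩ : {n : ℕ} (X T T′ : Subset n) → X ⊆ᵇ (T ∩ T′) ≡ (X ⊆ᵇ T ∧ X ⊆ᵇ T′)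
⊆ᵇ-∩ [] [] [] = refl
⊆ᵇ-∩ (outside ∷ X) (t ∷ T) (t′ ∷ T′) = ⊆ᵇ-∩ X T T′
⊆ᵇ-∩ (inside ∷ X) (outside ∷ T) (t′ ∷ T′) = refl
⊆ᵇ-∩ (inside ∷ X) (inside ∷ T) (outside ∷ T′) = sym (∧-zeroʳ _)
⊆ᵇ-∩ (inside ∷ X) (inside ∷ T) (inside ∷ T′) = ⊆ᵇ-∩ X T T′

∣∪∣+∣∩∣ : {n : ℕ} (T T′ : Subset n) → ∣ T ∪ T′ ∣ ℕ.+ ∣ T ∩ T′ ∣ ≡ ∣ T ∣ ℕ.+ ∣ T′ ∣
∣∪∣+∣∩∣ [] [] = refl
∣∪∣+∣∩∣ (outside ∷ T) (outside ∷ T′) = ∣∪∣+∣∩∣ T T′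
∣∪∣+∣∩∣ (outside ∷ T) (inside ∷ T′) = trans (cong suc (∣∪∣+∣∩∣ T T′)) (sym (+-suc ∣ T ∣ ∣ T′ ∣))
∣∪∣+∣∩∣ (inside ∷ T) (outside ∷ T′) = cong suc (∣∪∣+∣∩∣ T T′)
∣∪∣+∣∩∣ (inside ∷ T) (inside ∷ T′) =
  cong suc (trans (+-suc _ _) (trans (cong suc (∣∪∣+∣∩∣ T T′)) (sym (+-suc ∣ T ∣ ∣ T′ ∣))))

∣∩∣≡⇒≡ : {n : ℕ} (T T′ : Subset n) → ∣ T ∩ T′ ∣ ≡ ∣ T ∣ → ∣ T′ ∣ ≡ ∣ T ∣ → T ≡ T′
∣∩∣≡⇒≡ [] [] _ _ = refl
∣∩∣≡⇒≡ (outside ∷ T) (outside ∷ T′) e₁ e₂ = cong (outside ∷_) (∣∩∣≡⇒≡ T T′ e₁ e₂)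
∣∩∣≡⇒≡ (inside ∷ T) (inside ∷ T′) e₁ e₂ =
  cong (inside ∷_) (∣∩∣≡⇒≡ T T′ (suc-injective e₁) (suc-injective e₂))
∣∩∣≡⇒≡ (inside ∷ T) (outside ∷ T′) e₁ e₂ = ⊥-elim (1+n≰n (subst (ℕ._≤ ∣ T ∣) e₁ (∣p∩q∣≤∣p∣ T T′)))
∣∩∣≡⇒≡ (outside ∷ T) (inside ∷ T′) e₁ e₂ =
  ⊥-elim (1+n≰n (subst (ℕ._≤ ∣ T′ ∣) (sym e₂) (subst (ℕ._≤ ∣ T′ ∣) e₁ (∣p∩q∣≤∣q∣ T T′))))

between : {n : ℕ} → ℕ → Subset n → Subset n → Subset n → Bool
between k U V S = ∣ S ∣≡ᵇ k ∧ (U ⊆ᵇ S ∧ S ⊆ᵇ V)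

#between-small : (n k : ℕ) (U V : Subset n) → k ℕ.< ∣ U ∣ → ∑ˢ n (λ S → 𝟙 (between k U V S)) ≡ 0
#between-small n k U V k<U = ∑ˢ-zero n pt
  where
  pt : (S : Subset n) → 𝟙 (between k U V S) ≡ 0
  pt S with ∣ S ∣≡ᵇ k in e₁ | U ⊆ᵇ S in e₂
  ... | false | _ = refl
  ... | true | false = refl
  ... | true | true = ⊥-elim (<⇒≱ k<U (subst (∣ U ∣ ℕ.≤_) (≡ᵇ-sound _ _ e₁) (⊆ᵇ⇒∣∣≤ U S e₂)))

#between : (n : ℕ) (U V : Subset n) (j : ℕ) → U ⊆ᵇ V ≡ true →
  ∑ˢ n (λ S → 𝟙 (between (∣ U ∣ ℕ.+ j) U V S)) ≡ (∣ V ∣ ∸ ∣ U ∣) C j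
#between zero [] [] zero h = refl
#between zero [] [] (suc j) h = refl
#between (suc n) (outside ∷ U) (outside ∷ V) j h =
  trans (∑ˢ-suc n _) (trans (cong₂ ℕ._+_ (#between n U V j h) (∑ˢ-zero n (λ S → cong 𝟙 (none S))))
    (+-identityʳ _))
  where
  none : ∀ S → (∣ inside ∷ S ∣≡ᵇ (∣ U ∣ ℕ.+ j) ∧ (U ⊆ᵇ S ∧ false)) ≡ false
  none S rewrite ∧-zeroʳ (U ⊆ᵇ S) = ∧-zeroʳ _
#between (suc n) (outside ∷ U) (inside ∷ V) zero h =
  trans (∑ˢ-suc n _) (trans (cong₂ ℕ._+_ (#between n U V zero h) (∑ˢ-zero n none)) (+-identityʳ _))
  where
  none : (S : Subset n) → 𝟙 (between (∣ U ∣ ℕ.+ 0) (outside ∷ U) (inside ∷ V) (inside ∷ S)) ≡ 0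
  none S with suc ∣ S ∣ ≡ᵇ ∣ U ∣ ℕ.+ 0 in e₁ | U ⊆ᵇ S in e₂
  ... | false | _ = refl
  ... | true | false = refl
  ... | true | true =
    ⊥-elim (<⇒≱ (≤-reflexive (trans (≡ᵇ-sound _ _ e₁) (+-identityʳ _))) (⊆ᵇ⇒∣∣≤ U S e₂))
#between (suc n) (outside ∷ U) (inside ∷ V) (suc j) h = begin
  ∑ˢ (suc n) (λ S → 𝟙 (between (∣ U ∣ ℕ.+ suc j) (outside ∷ U) (inside ∷ V) S))
    ≡⟨ ∑ˢ-suc n _ ⟩
  ∑ˢ n (λ S → 𝟙 (between (∣ U ∣ ℕ.+ suc j) U V S))
    ℕ.+ ∑ˢ n (λ S → 𝟙 (between (∣ U ∣ ℕ.+ suc j) (outside ∷ U) (inside ∷ V) (inside ∷ S)))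
    ≡⟨ cong (∑ˢ n (λ S → 𝟙 (between (∣ U ∣ ℕ.+ suc j) U V S)) ℕ.+_) (∑ˢ-cong n (λ S →
         cong (λ k → 𝟙 (between k (outside ∷ U) (inside ∷ V) (inside ∷ S))) (+-suc ∣ U ∣ j))) ⟩
  ∑ˢ n (λ S → 𝟙 (between (∣ U ∣ ℕ.+ suc j) U V S)) ℕ.+ ∑ˢ n (λ S → 𝟙 (between (∣ U ∣ ℕ.+ j) U V S))
    ≡⟨ cong₂ ℕ._+_ (#between n U V (suc j) h) (#between n U V j h) ⟩
  m C suc j ℕ.+ m C j
    ≡⟨ trans (+-comm (m C suc j) (m C j)) (nCk+nC[k+1]≡[n+1]C[k+1] m j) ⟩
  suc m C suc j
    ≡⟨ cong (_C suc j) (sym (+-∸-assoc 1 (⊆ᵇ⇒∣∣≤ U V h))) ⟩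
  (suc ∣ V ∣ ∸ ∣ U ∣) C suc j ∎
  where
  open ≡-Reasoning
  m = ∣ V ∣ ∸ ∣ U ∣
#between (suc n) (inside ∷ U) (inside ∷ V) j h =
  trans (∑ˢ-suc n _) (cong₂ ℕ._+_ (∑ˢ-zero n (λ S → cong 𝟙 (∧-zeroʳ _))) (#between n U V j h))

#supersets : (n : ℕ) (U : Subset n) (k j : ℕ) → ∣ U ∣ ℕ.+ j ≡ k →
  ∑ˢ n (λ S → 𝟙 (∣ S ∣≡ᵇ k ∧ U ⊆ᵇ S)) ≡ (n ∸ ∣ U ∣) C j
#supersets n U k j refl = begin
  ∑ˢ n (λ S → 𝟙 (∣ S ∣≡ᵇ (∣ U ∣ ℕ.+ j) ∧ U ⊆ᵇ S))
    ≡⟨ ∑ˢ-cong n (λ S → cong (λ b → 𝟙 (∣ S ∣≡ᵇ (∣ U ∣ ℕ.+ j) ∧ b)) (sym (below-full S))) ⟩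
  ∑ˢ n (λ S → 𝟙 (between (∣ U ∣ ℕ.+ j) U full S))
    ≡⟨ #between n U full j (⊆ᵇ-full U) ⟩
  (∣ full {n} ∣ ∸ ∣ U ∣) C j
    ≡⟨ cong (λ m → (m ∸ ∣ U ∣) C j) (∣⊤∣≡n n) ⟩
  (n ∸ ∣ U ∣) C j ∎
  where
  open ≡-Reasoning
  below-full : ∀ S → (U ⊆ᵇ S ∧ S ⊆ᵇ full) ≡ U ⊆ᵇ S
  below-full S rewrite ⊆ᵇ-full S = ∧-identityʳ _

#supersets-small : (n : ℕ) (U : Subset n) (k : ℕ) → k ℕ.< ∣ U ∣ →
  ∑ˢ n (λ S → 𝟙 (∣ S ∣≡ᵇ k ∧ U ⊆ᵇ S)) ≡ 0
#supersets-small n U k k<U = trans (∑ˢ-cong n below-full) (#between-small n k U full k<U)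
  where
  below-full : ∀ S → 𝟙 (∣ S ∣≡ᵇ k ∧ U ⊆ᵇ S) ≡ 𝟙 (between k U full S)
  below-full S rewrite ⊆ᵇ-full S | ∧-identityʳ (U ⊆ᵇ S) = refl

#subsets : (n : ℕ) (V : Subset n) (k : ℕ) → ∑ˢ n (λ X → 𝟙 (∣ X ∣≡ᵇ k ∧ X ⊆ᵇ V)) ≡ ∣ V ∣ C k
#subsets n V k = begin
  ∑ˢ n (λ X → 𝟙 (∣ X ∣≡ᵇ k ∧ X ⊆ᵇ V))
    ≡⟨ ∑ˢ-cong n (λ X → cong (λ b → 𝟙 (∣ X ∣≡ᵇ k ∧ (b ∧ X ⊆ᵇ V))) (sym (∅-⊆ᵇ X))) ⟩
  ∑ˢ n (λ X → 𝟙 (between k ∅ V X))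
    ≡⟨ cong (λ m → ∑ˢ n (λ X → 𝟙 (between (m ℕ.+ k) ∅ V X))) (sym (∣⊥∣≡0 n)) ⟩
  ∑ˢ n (λ X → 𝟙 (between (∣ ∅ {n} ∣ ℕ.+ k) ∅ V X))
    ≡⟨ #between n ∅ V k (∅-⊆ᵇ V) ⟩
  (∣ V ∣ ∸ ∣ ∅ {n} ∣) C k
    ≡⟨ cong (λ m → (∣ V ∣ ∸ m) C k) (∣⊥∣≡0 n) ⟩
  ∣ V ∣ C k ∎
  where open ≡-Reasoning

-- Both sides equal ∣ T ∩ T′ ∣ C 2: a 4-set containing T ∪ T′ exists (and is unique) iff ∣ T ∩ T′ ∣ = 2.
#4-supersets≡#2-subsets : (n : ℕ) (T T′ : Subset n) → ∣ T ∣ ≡ 3 → ∣ T′ ∣ ≡ 3 → T ≢ T′ →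
  ∑ˢ n (λ S → 𝟙 (∣ S ∣≡ᵇ 4 ∧ (T ⊆ᵇ S ∧ T′ ⊆ᵇ S))) ≡ ∑ˢ n (λ X → 𝟙 (∣ X ∣≡ᵇ 2 ∧ (X ⊆ᵇ T ∧ X ⊆ᵇ T′)))
#4-supersets≡#2-subsets n T T′ ∣T∣≡3 ∣T′∣≡3 T≢T′ = trans (supersets _ refl) (sym subsets)
  where
  ∣∪∣+∣∩∣≡6 : ∣ T ∪ T′ ∣ ℕ.+ ∣ T ∩ T′ ∣ ≡ 6
  ∣∪∣+∣∩∣≡6 = trans (∣∪∣+∣∩∣ T T′) (cong₂ ℕ._+_ ∣T∣≡3 ∣T′∣≡3)
  union : ∑ˢ n (λ S → 𝟙 (∣ S ∣≡ᵇ 4 ∧ (T ⊆ᵇ S ∧ T′ ⊆ᵇ S))) ≡ ∑ˢ n (λ S → 𝟙 (∣ S ∣≡ᵇ 4 ∧ (T ∪ T′) ⊆ᵇ S))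
  union = ∑ˢ-cong n (λ S → cong (λ b → 𝟙 (∣ S ∣≡ᵇ 4 ∧ b)) (sym (∪-⊆ᵇ T T′ S)))
  subsets : ∑ˢ n (λ X → 𝟙 (∣ X ∣≡ᵇ 2 ∧ (X ⊆ᵇ T ∧ X ⊆ᵇ T′))) ≡ ∣ T ∩ T′ ∣ C 2
  subsets = trans (∑ˢ-cong n (λ X → cong (λ b → 𝟙 (∣ X ∣≡ᵇ 2 ∧ b)) (sym (⊆ᵇ-∩ X T T′)))) (#subsets n (T ∩ T′) 2)
  supersets : (i : ℕ) → ∣ T ∩ T′ ∣ ≡ i → ∑ˢ n (λ S → 𝟙 (∣ S ∣≡ᵇ 4 ∧ (T ⊆ᵇ S ∧ T′ ⊆ᵇ S))) ≡ i C 2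
  ∣∪∣+i≡6 : ∀ {i} → ∣ T ∩ T′ ∣ ≡ i → ∣ T ∪ T′ ∣ ℕ.+ i ≡ 6
  ∣∪∣+i≡6 refl = ∣∪∣+∣∩∣≡6
  supersets 0 e = trans union (#supersets-small n (T ∪ T′) 4
    (≤-trans (n≤1+n 5) (≤-reflexive (sym (trans (sym (+-identityʳ _)) (∣∪∣+i≡6 e))))))
  supersets 1 e = trans union (#supersets-small n (T ∪ T′) 4 (≤-reflexive (sym (+-cancelʳ-≡ 1 _ 5 (∣∪∣+i≡6 e)))))
  supersets 2 e = trans union (#supersets n (T ∪ T′) 4 0 (trans (+-identityʳ _) (+-cancelʳ-≡ 2 _ 4 (∣∪∣+i≡6 e))))
  supersets 3 ∣∩∣≡3 = ⊥-elim (T≢T′ (∣∩∣≡⇒≡ T T′ (trans ∣∩∣≡3 (sym ∣T∣≡3)) (trans ∣T′∣≡3 (sym ∣T∣≡3))))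
  supersets (suc (suc (suc (suc i)))) ∣∩∣≡4+i =
    ⊥-elim (1+n≰n (≤-trans (subst (ℕ._≤ 3) ∣∩∣≡4+i (subst (∣ T ∩ T′ ∣ ℕ.≤_) ∣T∣≡3 (∣p∩q∣≤∣p∣ T T′))) (s≤s (s≤s (s≤s z≤n)))))

∑-supersets-of-same-size : (n : ℕ) (X : Subset n) (g : Subset n → ℕ) →
  ∑ˢ n (λ T → 𝟙 (∣ T ∣≡ᵇ ∣ X ∣ ∧ X ⊆ᵇ T) ℕ.* g T) ≡ g X
∑-supersets-of-same-size zero [] g = trans (+-identityʳ _) (+-identityʳ (g []))
∑-supersets-of-same-size (suc n) (outside ∷ X) g =
  trans (∑ˢ-suc n _) (trans (cong₂ ℕ._+_ (∑-supersets-of-same-size n X (λ T → g (outside ∷ T))) (∑ˢ-zero n none))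
    (+-identityʳ _))
  where
  none : ∀ T → 𝟙 ((suc ∣ T ∣ ≡ᵇ ∣ X ∣) ∧ X ⊆ᵇ T) ℕ.* g (inside ∷ T) ≡ 0
  none T with suc ∣ T ∣ ≡ᵇ ∣ X ∣ in e₁ | X ⊆ᵇ T in e₂
  ... | false | _ = refl
  ... | true | false = refl
  ... | true | true = ⊥-elim (1+n≰n (subst (ℕ._≤ ∣ T ∣) (sym (≡ᵇ-sound _ _ e₁)) (⊆ᵇ⇒∣∣≤ X T e₂)))
∑-supersets-of-same-size (suc n) (inside ∷ X) g =
  trans (∑ˢ-suc n _) (cong₂ ℕ._+_ (∑ˢ-zero n none) (∑-supersets-of-same-size n X (λ T → g (inside ∷ T))))
  where
  none : ∀ T → 𝟙 ((∣ T ∣ ≡ᵇ suc ∣ X ∣) ∧ false) ℕ.* g (outside ∷ T) ≡ 0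
  none T = cong (λ b → 𝟙 b ℕ.* g (outside ∷ T)) (∧-zeroʳ (∣ T ∣ ≡ᵇ suc ∣ X ∣))

∑-one-point-extensions : (n : ℕ) (X : Subset n) (f : Subset n → ℕ) →
  ∑ˢ n (λ T → 𝟙 (∣ T ∣≡ᵇ suc ∣ X ∣ ∧ X ⊆ᵇ T) ℕ.* f T) ≡
  ∑ (List.allFin n) (λ z → 𝟙 (not (lookup X z)) ℕ.* f (X ∪ ⁅ z ⁆))
∑-one-point-extensions zero [] f = refl
∑-one-point-extensions (suc n) (outside ∷ X) f = begin
  ∑ˢ (suc n) (λ T → 𝟙 (∣ T ∣≡ᵇ suc ∣ X ∣ ∧ (outside ∷ X) ⊆ᵇ T) ℕ.* f T)
    ≡⟨ ∑ˢ-suc n _ ⟩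
  ∑ˢ n (λ T → 𝟙 (∣ T ∣≡ᵇ suc ∣ X ∣ ∧ X ⊆ᵇ T) ℕ.* f (outside ∷ T))
    ℕ.+ ∑ˢ n (λ T → 𝟙 (∣ T ∣≡ᵇ ∣ X ∣ ∧ X ⊆ᵇ T) ℕ.* f (inside ∷ T))
    ≡⟨ cong₂ ℕ._+_ (∑-one-point-extensions n X (λ T → f (outside ∷ T)))
                   (∑-supersets-of-same-size n X (λ T → f (inside ∷ T))) ⟩
  ∑ (List.allFin n) (λ z → 𝟙 (not (lookup X z)) ℕ.* f (outside ∷ (X ∪ ⁅ z ⁆))) ℕ.+ f (inside ∷ X)
    ≡⟨ +-comm _ (f (inside ∷ X)) ⟩
  f (inside ∷ X) ℕ.+ ∑ (List.allFin n) (λ z → 𝟙 (not (lookup X z)) ℕ.* f (outside ∷ (X ∪ ⁅ z ⁆)))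
    ≡⟨ cong (ℕ._+ ∑ (List.allFin n) (λ z → 𝟙 (not (lookup X z)) ℕ.* f (outside ∷ (X ∪ ⁅ z ⁆))))
         (trans (cong (λ Y → f (inside ∷ Y)) (sym (∪-identityʳ X))) (sym (+-identityʳ _))) ⟩
  𝟙 true ℕ.* f (inside ∷ (X ∪ ∅)) ℕ.+ ∑ (List.allFin n) (λ z → 𝟙 (not (lookup X z)) ℕ.* f (outside ∷ (X ∪ ⁅ z ⁆)))
    ≡⟨ sym (∑-allFin-suc n (λ z → 𝟙 (not (lookup (outside ∷ X) z)) ℕ.* f ((outside ∷ X) ∪ ⁅ z ⁆))) ⟩
  ∑ (List.allFin (suc n)) (λ z → 𝟙 (not (lookup (outside ∷ X) z)) ℕ.* f ((outside ∷ X) ∪ ⁅ z ⁆)) ∎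
  where open ≡-Reasoning
∑-one-point-extensions (suc n) (inside ∷ X) f = begin
  ∑ˢ (suc n) (λ T → 𝟙 (∣ T ∣≡ᵇ suc ∣ inside ∷ X ∣ ∧ (inside ∷ X) ⊆ᵇ T) ℕ.* f T)
    ≡⟨ ∑ˢ-suc n _ ⟩
  ∑ˢ n (λ T → 𝟙 ((∣ T ∣ ≡ᵇ suc (suc ∣ X ∣)) ∧ false) ℕ.* f (outside ∷ T))
    ℕ.+ ∑ˢ n (λ T → 𝟙 (∣ T ∣≡ᵇ suc ∣ X ∣ ∧ X ⊆ᵇ T) ℕ.* f (inside ∷ T))
    ≡⟨ cong₂ ℕ._+_ (∑ˢ-zero n (λ T → cong (λ b → 𝟙 b ℕ.* f (outside ∷ T)) (∧-zeroʳ (∣ T ∣ ≡ᵇ suc (suc ∣ X ∣)))))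
                   (∑-one-point-extensions n X (λ T → f (inside ∷ T))) ⟩
  ∑ (List.allFin n) (λ z → 𝟙 (not (lookup X z)) ℕ.* f (inside ∷ (X ∪ ⁅ z ⁆)))
    ≡⟨ sym (∑-allFin-suc n (λ z → 𝟙 (not (lookup (inside ∷ X) z)) ℕ.* f ((inside ∷ X) ∪ ⁅ z ⁆))) ⟩
  ∑ (List.allFin (suc n)) (λ z → 𝟙 (not (lookup (inside ∷ X) z)) ℕ.* f ((inside ∷ X) ∪ ⁅ z ⁆)) ∎
  where open ≡-Reasoning

∑-lookup≡∣∣ : {n : ℕ} (X : Subset n) → ∑ (List.allFin n) (λ z → 𝟙 (lookup X z)) ≡ ∣ X ∣
∑-lookup≡∣∣ [] = refl
∑-lookup≡∣∣ (outside ∷ X) = trans (∑-tabulate Fin.suc (λ z → 𝟙 (lookup (outside ∷ X) z))) (∑-lookup≡∣∣ X)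
∑-lookup≡∣∣ (inside ∷ X) = cong suc (trans (∑-tabulate Fin.suc (λ z → 𝟙 (lookup (inside ∷ X) z))) (∑-lookup≡∣∣ X))

⁅⁆-⊆ᵇ : {n : ℕ} (x : Fin n) (Y : Subset n) → ⁅ x ⁆ ⊆ᵇ Y ≡ lookup Y x
⁅⁆-⊆ᵇ Fin.zero (outside ∷ Y) = refl
⁅⁆-⊆ᵇ Fin.zero (inside ∷ Y) = ∅-⊆ᵇ Y
⁅⁆-⊆ᵇ (Fin.suc x) (y ∷ Y) = ⁅⁆-⊆ᵇ x Y

∣⁅⁆∩∣ : {n : ℕ} (B : Subset n) (x : Fin n) → ∣ ⁅ x ⁆ ∩ B ∣ ≡ 𝟙 (lookup B x)
∣⁅⁆∩∣ {suc n} (outside ∷ B) Fin.zero = trans (cong ∣_∣ (∩-zeroˡ B)) (∣⊥∣≡0 n)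
∣⁅⁆∩∣ {suc n} (inside ∷ B) Fin.zero = cong suc (trans (cong ∣_∣ (∩-zeroˡ B)) (∣⊥∣≡0 n))
∣⁅⁆∩∣ (b ∷ B) (Fin.suc x) = ∣⁅⁆∩∣ B x

∣∪⁅⁆∩∣ : {n : ℕ} (X B : Subset n) (z : Fin n) → lookup X z ≡ false →
  ∣ (X ∪ ⁅ z ⁆) ∩ B ∣ ≡ ∣ X ∩ B ∣ ℕ.+ 𝟙 (lookup B z)
∣∪⁅⁆∩∣ (outside ∷ X) (outside ∷ B) Fin.zero _ rewrite ∪-identityʳ X = sym (+-identityʳ _)
∣∪⁅⁆∩∣ (outside ∷ X) (inside ∷ B) Fin.zero _ rewrite ∪-identityʳ X = +-comm 1 _
∣∪⁅⁆∩∣ (outside ∷ X) (outside ∷ B) (Fin.suc z) h = ∣∪⁅⁆∩∣ X B z h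
∣∪⁅⁆∩∣ (outside ∷ X) (inside ∷ B) (Fin.suc z) h = ∣∪⁅⁆∩∣ X B z h
∣∪⁅⁆∩∣ (inside ∷ X) (outside ∷ B) (Fin.suc z) h = ∣∪⁅⁆∩∣ X B z h
∣∪⁅⁆∩∣ (inside ∷ X) (inside ∷ B) (Fin.suc z) h = cong suc (∣∪⁅⁆∩∣ X B z h)

-- Double counting in a 3-graph

isOdd : ℕ → Bool
isOdd zero = false
isOdd (suc n) = not (isOdd n)

4ab≤[a+b]² : ∀ a b → 4 ℕ.* (a ℕ.* b) ℕ.≤ (a ℕ.+ b) ℕ.* (a ℕ.+ b)
4ab≤[a+b]² a b = [ ordered a b , (λ b≤a → subst₂ ℕ._≤_ (cong (4 ℕ.*_) (*-comm b a))
                     (cong₂ ℕ._*_ (+-comm b a) (+-comm b a)) (ordered b a b≤a)) ]′ (≤-total a b)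
  where
  square : ∀ a d → (a ℕ.+ (a ℕ.+ d)) ℕ.* (a ℕ.+ (a ℕ.+ d)) ≡ 4 ℕ.* (a ℕ.* (a ℕ.+ d)) ℕ.+ d ℕ.* d
  square = solve-∀
  ordered : ∀ a b → a ℕ.≤ b → 4 ℕ.* (a ℕ.* b) ℕ.≤ (a ℕ.+ b) ℕ.* (a ℕ.+ b)
  ordered a b a≤b with m≤n⇒∃[o]m+o≡n a≤b
  ... | d , refl = subst (4 ℕ.* (a ℕ.* (a ℕ.+ d)) ℕ.≤_) (sym (square a d)) (m≤m+n _ _)

8[e≡2]≤2ea : (e a : ℕ) → e ℕ.+ a ≡ 4 → 8 ℕ.* 𝟙 (e ≡ᵇ 2) ℕ.≤ 2 ℕ.* (e ℕ.* a)
8[e≡2]≤2ea 0 a h = z≤n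
8[e≡2]≤2ea 1 a h = z≤n
8[e≡2]≤2ea 2 a h rewrite +-cancelˡ-≡ 2 a 2 h = ≤-refl
8[e≡2]≤2ea 3 a h = z≤n
8[e≡2]≤2ea 4 a h = z≤n

8[e≡2]≡2ea : (e a : ℕ) → e ℕ.+ a ≡ 4 → isOdd e ≡ false → 8 ℕ.* 𝟙 (e ≡ᵇ 2) ≡ 2 ℕ.* (e ℕ.* a)
8[e≡2]≡2ea 0 a h _ = refl
8[e≡2]≡2ea 2 a h _ rewrite +-cancelˡ-≡ 2 a 2 h = refl
8[e≡2]≡2ea 4 a h _ rewrite +-cancelˡ-≡ 4 a 0 h = refl

edgesInˢ : {n : ℕ} → ThreeGraph n → Subset n → ℕ
edgesInˢ {n} G S = ∑ˢ n (λ T → 𝟙 (∣ T ∣≡ᵇ 3 ∧ (isEdge G T ∧ T ⊆ᵇ S)))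

edgesIn≡edgesInˢ : {n : ℕ} (G : ThreeGraph n) (S : Subset n) → edgesIn G S ≡ edgesInˢ G S
edgesIn≡edgesInˢ {n} G S = begin
  edgesIn G S
    ≡⟨ length≡∑1 (filter (_⊆? S) edges) ⟩
  ∑ (filter (_⊆? S) edges) (λ _ → 1)
    ≡⟨ ∑-filter (_⊆? S) edges (λ _ → 1) ⟩
  ∑ edges (λ T → 𝟙 (T ⊆ᵇ S) ℕ.* 1)
    ≡⟨ ∑-filter (λ T → isEdge G T Bool.≟ true) (kSubsets n 3) _ ⟩
  ∑ (kSubsets n 3) (λ T → 𝟙 (does (isEdge G T Bool.≟ true)) ℕ.* (𝟙 (T ⊆ᵇ S) ℕ.* 1))
    ≡⟨ ∑-filter (λ T → ∣ T ∣ ℕ.≟ 3) (allSubsets n) _ ⟩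
  ∑ˢ n (λ T → 𝟙 (∣ T ∣≡ᵇ 3) ℕ.* (𝟙 (does (isEdge G T Bool.≟ true)) ℕ.* (𝟙 (T ⊆ᵇ S) ℕ.* 1)))
    ≡⟨ ∑ˢ-cong n pointwise ⟩
  edgesInˢ G S ∎
  where
  open ≡-Reasoning
  edges = filter (λ T → isEdge G T Bool.≟ true) (kSubsets n 3)
  does-≟true : ∀ b → does (b Bool.≟ true) ≡ b
  does-≟true false = refl
  does-≟true true = refl
  pointwise : ∀ T → 𝟙 (∣ T ∣≡ᵇ 3) ℕ.* (𝟙 (does (isEdge G T Bool.≟ true)) ℕ.* (𝟙 (T ⊆ᵇ S) ℕ.* 1))
                  ≡ 𝟙 (∣ T ∣≡ᵇ 3 ∧ (isEdge G T ∧ T ⊆ᵇ S))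
  pointwise T rewrite does-≟true (isEdge G T) | *-identityʳ (𝟙 (T ⊆ᵇ S))
                    | 𝟙-∧ (∣ T ∣≡ᵇ 3) (isEdge G T ∧ T ⊆ᵇ S) | 𝟙-∧ (isEdge G T) (T ⊆ᵇ S) = refl

e42≡∑ˢ : {n : ℕ} (G : ThreeGraph n) → e42 G ≡ ∑ˢ n (λ S → 𝟙 (∣ S ∣≡ᵇ 4 ∧ (edgesInˢ G S ≡ᵇ 2)))
e42≡∑ˢ {n} G = begin
  e42 G
    ≡⟨ length≡∑1 (filter (λ S → edgesIn G S ℕ.≟ 2) (kSubsets n 4)) ⟩
  ∑ (filter (λ S → edgesIn G S ℕ.≟ 2) (kSubsets n 4)) (λ _ → 1)
    ≡⟨ ∑-filter (λ S → edgesIn G S ℕ.≟ 2) (kSubsets n 4) (λ _ → 1) ⟩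
  ∑ (kSubsets n 4) (λ S → 𝟙 (edgesIn G S ≡ᵇ 2) ℕ.* 1)
    ≡⟨ ∑-filter (λ S → ∣ S ∣ ℕ.≟ 4) (allSubsets n) _ ⟩
  ∑ˢ n (λ S → 𝟙 (∣ S ∣≡ᵇ 4) ℕ.* (𝟙 (edgesIn G S ≡ᵇ 2) ℕ.* 1))
    ≡⟨ ∑ˢ-cong n pointwise ⟩
  ∑ˢ n (λ S → 𝟙 (∣ S ∣≡ᵇ 4 ∧ (edgesInˢ G S ≡ᵇ 2))) ∎
  where
  open ≡-Reasoning
  pointwise : ∀ S → 𝟙 (∣ S ∣≡ᵇ 4) ℕ.* (𝟙 (edgesIn G S ≡ᵇ 2) ℕ.* 1) ≡ 𝟙 (∣ S ∣≡ᵇ 4 ∧ (edgesInˢ G S ≡ᵇ 2))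
  pointwise S rewrite edgesIn≡edgesInˢ G S | *-identityʳ (𝟙 (edgesInˢ G S ≡ᵇ 2)) = sym (𝟙-∧ (∣ S ∣≡ᵇ 4) _)

-- Two triples with different edge status lie in a common 4-set S exactly when they share a pair X, so
-- counting such ordered pairs of triples through S or through X gives the same total W.
module Counting {n : ℕ} (G : ThreeGraph n) where

  E : Subset n → Bool
  E = isEdge G

  tripleIn tripleOver : Subset n → Subset n → Bool
  tripleIn S T = ∣ T ∣≡ᵇ 3 ∧ T ⊆ᵇ S
  tripleOver X T = ∣ T ∣≡ᵇ 3 ∧ X ⊆ᵇ T

  discordant : (Subset n → Bool) → ℕ
  discordant w = ∑ˢ n (λ T → ∑ˢ n (λ T′ → 𝟙 ((w T ∧ w T′) ∧ (E T xor E T′))))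

  nonEdgesIn codegree nonCodegree : Subset n → ℕ
  nonEdgesIn S = ∑ˢ n (λ T → 𝟙 (tripleIn S T ∧ not (E T)))
  codegree X = ∑ˢ n (λ T → 𝟙 (tripleOver X T ∧ E T))
  nonCodegree X = ∑ˢ n (λ T → 𝟙 (tripleOver X T ∧ not (E T)))

  W : ℕ
  W = ∑ˢ n (λ S → 𝟙 (∣ S ∣≡ᵇ 4) ℕ.* discordant (tripleIn S))

  private
    swap₃ : (h : Subset n → Subset n → Subset n → ℕ) →
      ∑ˢ n (λ S → ∑ˢ n (λ T → ∑ˢ n (λ T′ → h S T T′))) ≡ ∑ˢ n (λ T → ∑ˢ n (λ T′ → ∑ˢ n (λ S → h S T T′)))
    swap₃ h = trans (∑-comm (allSubsets n) (allSubsets n) (λ S T → ∑ˢ n (λ T′ → h S T T′)))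
      (∑ˢ-cong n (λ T → ∑-comm (allSubsets n) (allSubsets n) (λ S T′ → h S T T′)))

    pull : (c : Subset n → ℕ) (w : Subset n → Subset n → Subset n → Bool) (S : Subset n) →
      c S ℕ.* ∑ˢ n (λ T → ∑ˢ n (λ T′ → 𝟙 (w S T T′))) ≡ ∑ˢ n (λ T → ∑ˢ n (λ T′ → c S ℕ.* 𝟙 (w S T T′)))
    pull c w S = trans (sym (∑-*ˡ (allSubsets n) (c S) _)) (∑ˢ-cong n (λ T → sym (∑-*ˡ (allSubsets n) (c S) _)))

    𝟙-regroup : ∀ a b c d e f → 𝟙 a ℕ.* 𝟙 (((b ∧ c) ∧ (d ∧ e)) ∧ f) ≡ 𝟙 ((b ∧ d) ∧ f) ℕ.* 𝟙 (a ∧ (c ∧ e))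
    𝟙-regroup a b c d e f
      rewrite 𝟙-∧ ((b ∧ c) ∧ (d ∧ e)) f | 𝟙-∧ (b ∧ c) (d ∧ e) | 𝟙-∧ b c | 𝟙-∧ d e
            | 𝟙-∧ (b ∧ d) f | 𝟙-∧ b d | 𝟙-∧ a (c ∧ e) | 𝟙-∧ c e = ring (𝟙 a) (𝟙 b) (𝟙 c) (𝟙 d) (𝟙 e) (𝟙 f)
      where
      ring : ∀ a b c d e f → a ℕ.* (b ℕ.* c ℕ.* (d ℕ.* e) ℕ.* f) ≡ b ℕ.* d ℕ.* f ℕ.* (a ℕ.* (c ℕ.* e))
      ring = solve-∀

    xor-≢ : ∀ {T T′} → (E T xor E T′) ≡ true → T ≢ T′
    xor-≢ {T} h refl = case trans (sym h) (xor-same (E T)) of λ ()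

    common : (T T′ : Subset n) →
      𝟙 ((∣ T ∣≡ᵇ 3 ∧ ∣ T′ ∣≡ᵇ 3) ∧ (E T xor E T′)) ℕ.* ∑ˢ n (λ S → 𝟙 (∣ S ∣≡ᵇ 4 ∧ (T ⊆ᵇ S ∧ T′ ⊆ᵇ S))) ≡
      𝟙 ((∣ T ∣≡ᵇ 3 ∧ ∣ T′ ∣≡ᵇ 3) ∧ (E T xor E T′)) ℕ.* ∑ˢ n (λ X → 𝟙 (∣ X ∣≡ᵇ 2 ∧ (X ⊆ᵇ T ∧ X ⊆ᵇ T′)))
    common T T′ with ∣ T ∣≡ᵇ 3 in e₁ | ∣ T′ ∣≡ᵇ 3 in e₂ | E T xor E T′ in e₃
    ... | false | _ | _ = refl
    ... | true | false | _ = refl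
    ... | true | true | false = refl
    ... | true | true | true = cong (1 ℕ.*_)
      (#4-supersets≡#2-subsets n T T′ (≡ᵇ-sound _ _ e₁) (≡ᵇ-sound _ _ e₂) (xor-≢ e₃))

  W≡∑-pairs : W ≡ ∑ˢ n (λ X → 𝟙 (∣ X ∣≡ᵇ 2) ℕ.* discordant (tripleOver X))
  W≡∑-pairs = begin
    ∑ˢ n (λ S → 𝟙 (∣ S ∣≡ᵇ 4) ℕ.* discordant (tripleIn S))
      ≡⟨ ∑ˢ-cong n (pull (λ S → 𝟙 (∣ S ∣≡ᵇ 4)) (λ S T T′ → (tripleIn S T ∧ tripleIn S T′) ∧ (E T xor E T′))) ⟩
    ∑ˢ n (λ S → ∑ˢ n (λ T → ∑ˢ n (λ T′ → 𝟙 (∣ S ∣≡ᵇ 4) ℕ.* 𝟙 ((tripleIn S T ∧ tripleIn S T′) ∧ (E T xor E T′)))))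
      ≡⟨ swap₃ _ ⟩
    ∑ˢ n (λ T → ∑ˢ n (λ T′ → ∑ˢ n (λ S → 𝟙 (∣ S ∣≡ᵇ 4) ℕ.* 𝟙 ((tripleIn S T ∧ tripleIn S T′) ∧ (E T xor E T′)))))
      ≡⟨ ∑ˢ-cong n (λ T → ∑ˢ-cong n (λ T′ → through-S T T′)) ⟩
    ∑ˢ n (λ T → ∑ˢ n (λ T′ → 𝟙 (pair T T′) ℕ.* ∑ˢ n (λ S → 𝟙 (∣ S ∣≡ᵇ 4 ∧ (T ⊆ᵇ S ∧ T′ ⊆ᵇ S)))))
      ≡⟨ ∑ˢ-cong n (λ T → ∑ˢ-cong n (λ T′ → common T T′)) ⟩
    ∑ˢ n (λ T → ∑ˢ n (λ T′ → 𝟙 (pair T T′) ℕ.* ∑ˢ n (λ X → 𝟙 (∣ X ∣≡ᵇ 2 ∧ (X ⊆ᵇ T ∧ X ⊆ᵇ T′)))))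
      ≡⟨ ∑ˢ-cong n (λ T → ∑ˢ-cong n (λ T′ → sym (through-X T T′))) ⟩
    ∑ˢ n (λ T → ∑ˢ n (λ T′ → ∑ˢ n (λ X → 𝟙 (∣ X ∣≡ᵇ 2) ℕ.* 𝟙 ((tripleOver X T ∧ tripleOver X T′) ∧ (E T xor E T′)))))
      ≡⟨ sym (swap₃ _) ⟩
    ∑ˢ n (λ X → ∑ˢ n (λ T → ∑ˢ n (λ T′ → 𝟙 (∣ X ∣≡ᵇ 2) ℕ.* 𝟙 ((tripleOver X T ∧ tripleOver X T′) ∧ (E T xor E T′)))))
      ≡⟨ ∑ˢ-cong n (λ X → sym (pull (λ X → 𝟙 (∣ X ∣≡ᵇ 2)) (λ X T T′ → (tripleOver X T ∧ tripleOver X T′) ∧ (E T xor E T′)) X)) ⟩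
    ∑ˢ n (λ X → 𝟙 (∣ X ∣≡ᵇ 2) ℕ.* discordant (tripleOver X)) ∎
    where
    open ≡-Reasoning
    pair : Subset n → Subset n → Bool
    pair T T′ = (∣ T ∣≡ᵇ 3 ∧ ∣ T′ ∣≡ᵇ 3) ∧ (E T xor E T′)
    through-S : ∀ T T′ → ∑ˢ n (λ S → 𝟙 (∣ S ∣≡ᵇ 4) ℕ.* 𝟙 ((tripleIn S T ∧ tripleIn S T′) ∧ (E T xor E T′)))
                         ≡ 𝟙 (pair T T′) ℕ.* ∑ˢ n (λ S → 𝟙 (∣ S ∣≡ᵇ 4 ∧ (T ⊆ᵇ S ∧ T′ ⊆ᵇ S)))
    through-S T T′ = trans (∑ˢ-cong n (λ S → 𝟙-regroup (∣ S ∣≡ᵇ 4) (∣ T ∣≡ᵇ 3) (T ⊆ᵇ S) (∣ T′ ∣≡ᵇ 3) (T′ ⊆ᵇ S) (E T xor E T′))) (∑-*ˡ (allSubsets n) (𝟙 (pair T T′)) _)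
    through-X : ∀ T T′ → ∑ˢ n (λ X → 𝟙 (∣ X ∣≡ᵇ 2) ℕ.* 𝟙 ((tripleOver X T ∧ tripleOver X T′) ∧ (E T xor E T′)))
                         ≡ 𝟙 (pair T T′) ℕ.* ∑ˢ n (λ X → 𝟙 (∣ X ∣≡ᵇ 2 ∧ (X ⊆ᵇ T ∧ X ⊆ᵇ T′)))
    through-X T T′ = trans (∑ˢ-cong n (λ X → 𝟙-regroup (∣ X ∣≡ᵇ 2) (∣ T ∣≡ᵇ 3) (X ⊆ᵇ T) (∣ T′ ∣≡ᵇ 3) (X ⊆ᵇ T′) (E T xor E T′))) (∑-*ˡ (allSubsets n) (𝟙 (pair T T′)) _)

  private
    reassoc : ∀ a b c → ((a ∧ b) ∧ c) ≡ (a ∧ (c ∧ b))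
    reassoc a b c rewrite ∧-assoc a b c | ∧-comm b c = refl

  edgesIn≡∑-tripleIn : (S : Subset n) → ∑ˢ n (λ T → 𝟙 (tripleIn S T ∧ E T)) ≡ edgesInˢ G S
  edgesIn≡∑-tripleIn S = ∑ˢ-cong n (λ T → cong 𝟙 (reassoc (∣ T ∣≡ᵇ 3) (T ⊆ᵇ S) (E T)))

  discordant-in : (S : Subset n) → discordant (tripleIn S) ≡ 2 ℕ.* (edgesInˢ G S ℕ.* nonEdgesIn S)
  discordant-in S = trans (∑-xor (allSubsets n) (tripleIn S) E)
    (cong (λ e → 2 ℕ.* (e ℕ.* nonEdgesIn S)) (edgesIn≡∑-tripleIn S))

  edges+nonEdges : (S : Subset n) → ∣ S ∣≡ᵇ 4 ≡ true → edgesInˢ G S ℕ.+ nonEdgesIn S ≡ 4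
  edges+nonEdges S h = begin
    edgesInˢ G S ℕ.+ nonEdgesIn S                 ≡⟨ cong (ℕ._+ nonEdgesIn S) (sym (edgesIn≡∑-tripleIn S)) ⟩
    ∑ˢ n (λ T → 𝟙 (tripleIn S T ∧ E T)) ℕ.+ nonEdgesIn S ≡⟨ ∑-partition (allSubsets n) (tripleIn S) E ⟩
    ∑ˢ n (λ T → 𝟙 (tripleIn S T))                  ≡⟨ #subsets n S 3 ⟩
    ∣ S ∣ C 3                                      ≡⟨ cong (_C 3) (≡ᵇ-sound ∣ S ∣ 4 h) ⟩
    4                                              ∎
    where open ≡-Reasoning

  discordant-over : (X : Subset n) → discordant (tripleOver X) ≡ 2 ℕ.* (codegree X ℕ.* nonCodegree X)
  discordant-over X = ∑-xor (allSubsets n) (tripleOver X) E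

  codegree+nonCodegree : (X : Subset n) → ∣ X ∣≡ᵇ 2 ≡ true → codegree X ℕ.+ nonCodegree X ≡ n ∸ 2
  codegree+nonCodegree X h = begin
    codegree X ℕ.+ nonCodegree X       ≡⟨ ∑-partition (allSubsets n) (tripleOver X) E ⟩
    ∑ˢ n (λ T → 𝟙 (tripleOver X T))    ≡⟨ #supersets n X 3 1 (cong (ℕ._+ 1) ∣X∣≡2) ⟩
    (n ∸ ∣ X ∣) C 1                    ≡⟨ cong (λ m → (n ∸ m) C 1) ∣X∣≡2 ⟩
    (n ∸ 2) C 1                        ≡⟨ nC1≡n (n ∸ 2) ⟩
    n ∸ 2                              ∎
    where
    open ≡-Reasoning
    ∣X∣≡2 : ∣ X ∣ ≡ 2
    ∣X∣≡2 = ≡ᵇ-sound ∣ X ∣ 2 h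

  W≡∑-codegrees : W ≡ ∑ˢ n (λ X → 𝟙 (∣ X ∣≡ᵇ 2) ℕ.* (2 ℕ.* (codegree X ℕ.* nonCodegree X)))
  W≡∑-codegrees = trans W≡∑-pairs (∑ˢ-cong n (λ X → cong (𝟙 (∣ X ∣≡ᵇ 2) ℕ.*_) (discordant-over X)))

  8e42≤W : 8 ℕ.* e42 G ℕ.≤ W
  8e42≤W = begin
    8 ℕ.* e42 G                                                  ≡⟨ cong (8 ℕ.*_) (e42≡∑ˢ G) ⟩
    8 ℕ.* ∑ˢ n (λ S → 𝟙 (∣ S ∣≡ᵇ 4 ∧ (edgesInˢ G S ≡ᵇ 2)))       ≡⟨ sym (∑-*ˡ (allSubsets n) 8 _) ⟩
    ∑ˢ n (λ S → 8 ℕ.* 𝟙 (∣ S ∣≡ᵇ 4 ∧ (edgesInˢ G S ≡ᵇ 2)))       ≤⟨ ∑-mono-≤ (allSubsets n) pointwise ⟩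
    W                                                            ∎
    where
    open ≤-Reasoning
    pointwise : (S : Subset n) → 8 ℕ.* 𝟙 (∣ S ∣≡ᵇ 4 ∧ (edgesInˢ G S ≡ᵇ 2)) ℕ.≤ 𝟙 (∣ S ∣≡ᵇ 4) ℕ.* discordant (tripleIn S)
    pointwise S with ∣ S ∣≡ᵇ 4 in h
    ... | false = z≤n
    ... | true = subst (8 ℕ.* 𝟙 (edgesInˢ G S ≡ᵇ 2) ℕ.≤_) (sym (trans (+-identityʳ _) (discordant-in S)))
                   (8[e≡2]≤2ea (edgesInˢ G S) (nonEdgesIn S) (edges+nonEdges S h))

  8e42≡W : (∀ S → ∣ S ∣≡ᵇ 4 ≡ true → isOdd (edgesInˢ G S) ≡ false) → 8 ℕ.* e42 G ≡ W
  8e42≡W even = begin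
    8 ℕ.* e42 G                                                  ≡⟨ cong (8 ℕ.*_) (e42≡∑ˢ G) ⟩
    8 ℕ.* ∑ˢ n (λ S → 𝟙 (∣ S ∣≡ᵇ 4 ∧ (edgesInˢ G S ≡ᵇ 2)))       ≡⟨ sym (∑-*ˡ (allSubsets n) 8 _) ⟩
    ∑ˢ n (λ S → 8 ℕ.* 𝟙 (∣ S ∣≡ᵇ 4 ∧ (edgesInˢ G S ≡ᵇ 2)))       ≡⟨ ∑ˢ-cong n pointwise ⟩
    W                                                            ∎
    where
    open ≡-Reasoning
    pointwise : (S : Subset n) → 8 ℕ.* 𝟙 (∣ S ∣≡ᵇ 4 ∧ (edgesInˢ G S ≡ᵇ 2)) ≡ 𝟙 (∣ S ∣≡ᵇ 4) ℕ.* discordant (tripleIn S)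
    pointwise S with ∣ S ∣≡ᵇ 4 in h
    ... | false = refl
    ... | true = trans (8[e≡2]≡2ea (edgesInˢ G S) (nonEdgesIn S) (edges+nonEdges S h) (even S h))
                   (sym (trans (+-identityʳ _) (discordant-in S)))

  #pairs : ∑ˢ n (λ X → 𝟙 (∣ X ∣≡ᵇ 2)) ≡ n C 2
  #pairs = trans (∑ˢ-cong n in-full) (trans (#subsets n full 2) (cong (_C 2) (∣⊤∣≡n n)))
    where
    in-full : ∀ X → 𝟙 (∣ X ∣≡ᵇ 2) ≡ 𝟙 (∣ X ∣≡ᵇ 2 ∧ X ⊆ᵇ full)
    in-full X rewrite ⊆ᵇ-full X | ∧-identityʳ (∣ X ∣≡ᵇ 2) = refl

  4W≤2[n-2]²C[n,2] : 4 ℕ.* W ℕ.≤ 2 ℕ.* ((n ∸ 2) ℕ.* (n ∸ 2)) ℕ.* (n C 2)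
  4W≤2[n-2]²C[n,2] = begin
    4 ℕ.* W
      ≡⟨ cong (4 ℕ.*_) W≡∑-codegrees ⟩
    4 ℕ.* ∑ˢ n (λ X → 𝟙 (∣ X ∣≡ᵇ 2) ℕ.* (2 ℕ.* (codegree X ℕ.* nonCodegree X)))
      ≡⟨ sym (∑-*ˡ (allSubsets n) 4 _) ⟩
    ∑ˢ n (λ X → 4 ℕ.* (𝟙 (∣ X ∣≡ᵇ 2) ℕ.* (2 ℕ.* (codegree X ℕ.* nonCodegree X))))
      ≤⟨ ∑-mono-≤ (allSubsets n) pointwise ⟩
    ∑ˢ n (λ X → 2 ℕ.* ((n ∸ 2) ℕ.* (n ∸ 2)) ℕ.* 𝟙 (∣ X ∣≡ᵇ 2))
      ≡⟨ ∑-*ˡ (allSubsets n) (2 ℕ.* ((n ∸ 2) ℕ.* (n ∸ 2))) _ ⟩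
    2 ℕ.* ((n ∸ 2) ℕ.* (n ∸ 2)) ℕ.* ∑ˢ n (λ X → 𝟙 (∣ X ∣≡ᵇ 2))
      ≡⟨ cong (2 ℕ.* ((n ∸ 2) ℕ.* (n ∸ 2)) ℕ.*_) #pairs ⟩
    2 ℕ.* ((n ∸ 2) ℕ.* (n ∸ 2)) ℕ.* (n C 2) ∎
    where
    open ≤-Reasoning
    regroup : ∀ a b → 4 ℕ.* (2 ℕ.* (a ℕ.* b)) ≡ 2 ℕ.* (4 ℕ.* (a ℕ.* b))
    regroup = solve-∀
    pointwise : (X : Subset n) → 4 ℕ.* (𝟙 (∣ X ∣≡ᵇ 2) ℕ.* (2 ℕ.* (codegree X ℕ.* nonCodegree X)))
                               ℕ.≤ 2 ℕ.* ((n ∸ 2) ℕ.* (n ∸ 2)) ℕ.* 𝟙 (∣ X ∣≡ᵇ 2)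
    pointwise X with ∣ X ∣≡ᵇ 2 in h
    ... | false = ≤-reflexive (sym (*-zeroʳ (2 ℕ.* ((n ∸ 2) ℕ.* (n ∸ 2)))))
    ... | true = begin
      4 ℕ.* (2 ℕ.* (codegree X ℕ.* nonCodegree X) ℕ.+ 0)
        ≡⟨ cong (4 ℕ.*_) (+-identityʳ (2 ℕ.* (codegree X ℕ.* nonCodegree X))) ⟩
      4 ℕ.* (2 ℕ.* (codegree X ℕ.* nonCodegree X))
        ≡⟨ regroup (codegree X) (nonCodegree X) ⟩
      2 ℕ.* (4 ℕ.* (codegree X ℕ.* nonCodegree X))
        ≤⟨ *-monoʳ-≤ 2 (4ab≤[a+b]² (codegree X) (nonCodegree X)) ⟩
      2 ℕ.* ((codegree X ℕ.+ nonCodegree X) ℕ.* (codegree X ℕ.+ nonCodegree X))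
        ≡⟨ cong (λ m → 2 ℕ.* (m ℕ.* m)) (codegree+nonCodegree X h) ⟩
      2 ℕ.* ((n ∸ 2) ℕ.* (n ∸ 2))
        ≡⟨ sym (*-identityʳ _) ⟩
      2 ℕ.* ((n ∸ 2) ℕ.* (n ∸ 2)) ℕ.* 1 ∎

  4e42≡∑-codegrees : (∀ S → ∣ S ∣≡ᵇ 4 ≡ true → isOdd (edgesInˢ G S) ≡ false) →
    4 ℕ.* e42 G ≡ ∑ˢ n (λ X → 𝟙 (∣ X ∣≡ᵇ 2) ℕ.* (codegree X ℕ.* nonCodegree X))
  4e42≡∑-codegrees even = *-cancelˡ-≡ _ _ 2 (begin
    2 ℕ.* (4 ℕ.* e42 G)                                                       ≡⟨ sym (*-assoc 2 4 (e42 G)) ⟩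
    8 ℕ.* e42 G                                                               ≡⟨ 8e42≡W even ⟩
    W                                                                         ≡⟨ W≡∑-codegrees ⟩
    ∑ˢ n (λ X → 𝟙 (∣ X ∣≡ᵇ 2) ℕ.* (2 ℕ.* (codegree X ℕ.* nonCodegree X)))     ≡⟨ ∑ˢ-cong n (λ X → swap (𝟙 (∣ X ∣≡ᵇ 2)) (codegree X ℕ.* nonCodegree X)) ⟩
    ∑ˢ n (λ X → 2 ℕ.* (𝟙 (∣ X ∣≡ᵇ 2) ℕ.* (codegree X ℕ.* nonCodegree X)))     ≡⟨ ∑-*ˡ (allSubsets n) 2 _ ⟩
    2 ℕ.* ∑ˢ n (λ X → 𝟙 (∣ X ∣≡ᵇ 2) ℕ.* (codegree X ℕ.* nonCodegree X))       ∎)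
    where
    open ≡-Reasoning
    swap : ∀ a b → a ℕ.* (2 ℕ.* b) ≡ 2 ℕ.* (a ℕ.* b)
    swap = solve-∀

16e42≤[n-2]²C[n,2] : {n : ℕ} (G : ThreeGraph n) → 16 ℕ.* e42 G ℕ.≤ ((n ∸ 2) ℕ.* (n ∸ 2)) ℕ.* (n C 2)
16e42≤[n-2]²C[n,2] {n} G = *-cancelˡ-≤ 2 (begin
  2 ℕ.* (16 ℕ.* e42 G)                              ≡⟨ regroup (e42 G) ⟩
  4 ℕ.* (8 ℕ.* e42 G)                               ≤⟨ *-monoʳ-≤ 4 (8e42≤W) ⟩
  4 ℕ.* W                                           ≤⟨ 4W≤2[n-2]²C[n,2] ⟩
  2 ℕ.* ((n ∸ 2) ℕ.* (n ∸ 2)) ℕ.* (n C 2)            ≡⟨ *-assoc 2 ((n ∸ 2) ℕ.* (n ∸ 2)) (n C 2) ⟩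
  2 ℕ.* ((n ∸ 2) ℕ.* (n ∸ 2) ℕ.* (n C 2))            ∎)
  where
  open ≤-Reasoning
  open Counting G
  regroup : ∀ e → 2 ℕ.* (16 ℕ.* e) ≡ 4 ℕ.* (8 ℕ.* e)
  regroup = solve-∀

-- Parity graphs

isOdd-+ : ∀ a b → isOdd (a ℕ.+ b) ≡ (isOdd a xor isOdd b)
isOdd-+ zero b = refl
isOdd-+ (suc a) b rewrite isOdd-+ a b = sym (xor-assoc true (isOdd a) (isOdd b))

isOdd-∑ : {A : Set} (xs : List A) {f g : A → ℕ} → (∀ x → isOdd (f x) ≡ isOdd (g x)) →
  isOdd (∑ xs f) ≡ isOdd (∑ xs g)
isOdd-∑ [] eq = refl
isOdd-∑ (x ∷ xs) {f} {g} eq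
  rewrite isOdd-+ (f x) (∑ xs f) | isOdd-+ (g x) (∑ xs g) | eq x | isOdd-∑ xs {f} {g} eq = refl

isOdd-2* : ∀ a → isOdd (2 ℕ.* a) ≡ false
isOdd-2* a rewrite +-identityʳ a | isOdd-+ a a = xor-same (isOdd a)

isOdd-𝟙* : ∀ w q → isOdd (𝟙 w ℕ.* q) ≡ (w ∧ isOdd q)
isOdd-𝟙* false q = refl
isOdd-𝟙* true q rewrite +-identityʳ q = refl

isOdd-𝟙 : ∀ b → isOdd (𝟙 b) ≡ b
isOdd-𝟙 false = refl
isOdd-𝟙 true = refl

#between-⊈ : (n k : ℕ) (U V : Subset n) → U ⊆ᵇ V ≡ false → ∑ˢ n (λ S → 𝟙 (between k U V S)) ≡ 0
#between-⊈ n k U V U⊈V = ∑ˢ-zero n none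
  where
  none : (S : Subset n) → 𝟙 (between k U V S) ≡ 0
  none S with U ⊆ᵇ S in e₁ | S ⊆ᵇ V in e₂
  ... | false | _ = cong 𝟙 (∧-zeroʳ _)
  ... | true | false = cong 𝟙 (∧-zeroʳ _)
  ... | true | true = case trans (sym U⊈V) (⊆ᵇ-trans U S V e₁ e₂) of λ ()

#triples-between : (n : ℕ) (X S : Subset n) → ∣ X ∣≡ᵇ 2 ≡ true → ∣ S ∣≡ᵇ 4 ≡ true →
  ∑ˢ n (λ T → 𝟙 (between 3 X S T)) ≡ 2 ℕ.* 𝟙 (X ⊆ᵇ S)
#triples-between n X S hX hS with X ⊆ᵇ S in X⊆S
... | false = #between-⊈ n 3 X S X⊆S
... | true = begin
  ∑ˢ n (λ T → 𝟙 (between 3 X S T))                  ≡⟨ cong (λ k → ∑ˢ n (λ T → 𝟙 (between (k ℕ.+ 1) X S T))) (sym ∣X∣≡2) ⟩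
  ∑ˢ n (λ T → 𝟙 (between (∣ X ∣ ℕ.+ 1) X S T))      ≡⟨ #between n X S 1 X⊆S ⟩
  (∣ S ∣ ∸ ∣ X ∣) C 1                               ≡⟨ cong₂ (λ a b → (a ∸ b) C 1) (≡ᵇ-sound ∣ S ∣ 4 hS) ∣X∣≡2 ⟩
  2                                                 ∎
  where
  open ≡-Reasoning
  ∣X∣≡2 : ∣ X ∣ ≡ 2
  ∣X∣≡2 = ≡ᵇ-sound ∣ X ∣ 2 hX

module ParityGraph {n : ℕ} {I : Set} (J : List I) (B : I → Subset n) where

  sharedPairs : Subset n → ℕ
  sharedPairs T = ∑ J (λ j → ∣ T ∩ B j ∣ C 2)

  G : ThreeGraph n
  G = record { isEdge = λ T → isOdd (sharedPairs T) }

  -- Each pair X ⊆ S lies in exactly two triples T ⊆ S when ∣ S ∣ = 4, so every pair is counted twice.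
  even : (S : Subset n) → ∣ S ∣≡ᵇ 4 ≡ true → isOdd (edgesInˢ G S) ≡ false
  even S hS = begin
    isOdd (edgesInˢ G S)
      ≡⟨ isOdd-∑ (allSubsets n) (λ T → parity-term T) ⟩
    isOdd (∑ˢ n (λ T → 𝟙 (∣ T ∣≡ᵇ 3 ∧ T ⊆ᵇ S) ℕ.* sharedPairs T))
      ≡⟨ cong isOdd pairs-twice ⟩
    isOdd (2 ℕ.* ∑ J (λ j → ∑ˢ n (λ X → 𝟙 (∣ X ∣≡ᵇ 2 ∧ X ⊆ᵇ B j) ℕ.* 𝟙 (X ⊆ᵇ S))))
      ≡⟨ isOdd-2* (∑ J (λ j → ∑ˢ n (λ X → 𝟙 (∣ X ∣≡ᵇ 2 ∧ X ⊆ᵇ B j) ℕ.* 𝟙 (X ⊆ᵇ S)))) ⟩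
    false ∎
    where
    open ≡-Reasoning
    parity-term : ∀ T → isOdd (𝟙 (∣ T ∣≡ᵇ 3 ∧ (isOdd (sharedPairs T) ∧ T ⊆ᵇ S)))
                        ≡ isOdd (𝟙 (∣ T ∣≡ᵇ 3 ∧ T ⊆ᵇ S) ℕ.* sharedPairs T)
    parity-term T rewrite isOdd-𝟙 (∣ T ∣≡ᵇ 3 ∧ (isOdd (sharedPairs T) ∧ T ⊆ᵇ S))
                        | isOdd-𝟙* (∣ T ∣≡ᵇ 3 ∧ T ⊆ᵇ S) (sharedPairs T)
                        | ∧-comm (isOdd (sharedPairs T)) (T ⊆ᵇ S) = sym (∧-assoc (∣ T ∣≡ᵇ 3) (T ⊆ᵇ S) _)
    regroup : ∀ a b c d e → 𝟙 (a ∧ b) ℕ.* 𝟙 (c ∧ (d ∧ e)) ≡ 𝟙 (c ∧ e) ℕ.* 𝟙 (a ∧ (d ∧ b))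
    regroup a b c d e rewrite 𝟙-∧ a b | 𝟙-∧ c (d ∧ e) | 𝟙-∧ d e | 𝟙-∧ c e | 𝟙-∧ a (d ∧ b) | 𝟙-∧ d b
      = ring (𝟙 a) (𝟙 b) (𝟙 c) (𝟙 d) (𝟙 e)
      where
      ring : ∀ a b c d e → a ℕ.* b ℕ.* (c ℕ.* (d ℕ.* e)) ≡ c ℕ.* e ℕ.* (a ℕ.* (d ℕ.* b))
      ring = solve-∀
    per-pair : ∀ j X → 𝟙 (∣ X ∣≡ᵇ 2 ∧ X ⊆ᵇ B j) ℕ.* ∑ˢ n (λ T → 𝟙 (between 3 X S T))
                     ≡ 2 ℕ.* (𝟙 (∣ X ∣≡ᵇ 2 ∧ X ⊆ᵇ B j) ℕ.* 𝟙 (X ⊆ᵇ S))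
    per-pair j X with ∣ X ∣≡ᵇ 2 in hX
    ... | false = sym (*-zeroʳ 2)
    ... | true rewrite #triples-between n X S hX hS = swap (𝟙 (X ⊆ᵇ B j)) (𝟙 (X ⊆ᵇ S))
      where
      swap : ∀ a b → a ℕ.* (2 ℕ.* b) ≡ 2 ℕ.* (a ℕ.* b)
      swap = solve-∀
    pairs-twice : ∑ˢ n (λ T → 𝟙 (∣ T ∣≡ᵇ 3 ∧ T ⊆ᵇ S) ℕ.* sharedPairs T)
                  ≡ 2 ℕ.* ∑ J (λ j → ∑ˢ n (λ X → 𝟙 (∣ X ∣≡ᵇ 2 ∧ X ⊆ᵇ B j) ℕ.* 𝟙 (X ⊆ᵇ S)))
    pairs-twice = begin
      ∑ˢ n (λ T → 𝟙 (∣ T ∣≡ᵇ 3 ∧ T ⊆ᵇ S) ℕ.* sharedPairs T)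
        ≡⟨ ∑ˢ-cong n (λ T → trans (sym (∑-*ˡ J (𝟙 (∣ T ∣≡ᵇ 3 ∧ T ⊆ᵇ S)) (λ j → ∣ T ∩ B j ∣ C 2))) (∑-cong J (λ j → expand T j))) ⟩
      ∑ˢ n (λ T → ∑ J (λ j → ∑ˢ n (λ X → 𝟙 (∣ T ∣≡ᵇ 3 ∧ T ⊆ᵇ S) ℕ.* 𝟙 (∣ X ∣≡ᵇ 2 ∧ (X ⊆ᵇ T ∧ X ⊆ᵇ B j)))))
        ≡⟨ ∑-comm (allSubsets n) J _ ⟩
      ∑ J (λ j → ∑ˢ n (λ T → ∑ˢ n (λ X → 𝟙 (∣ T ∣≡ᵇ 3 ∧ T ⊆ᵇ S) ℕ.* 𝟙 (∣ X ∣≡ᵇ 2 ∧ (X ⊆ᵇ T ∧ X ⊆ᵇ B j)))))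
        ≡⟨ ∑-cong J (λ j → ∑-comm (allSubsets n) (allSubsets n) _) ⟩
      ∑ J (λ j → ∑ˢ n (λ X → ∑ˢ n (λ T → 𝟙 (∣ T ∣≡ᵇ 3 ∧ T ⊆ᵇ S) ℕ.* 𝟙 (∣ X ∣≡ᵇ 2 ∧ (X ⊆ᵇ T ∧ X ⊆ᵇ B j)))))
        ≡⟨ ∑-cong J (λ j → ∑ˢ-cong n (λ X → trans
             (∑ˢ-cong n (λ T → regroup (∣ T ∣≡ᵇ 3) (T ⊆ᵇ S) (∣ X ∣≡ᵇ 2) (X ⊆ᵇ T) (X ⊆ᵇ B j)))
             (∑-*ˡ (allSubsets n) (𝟙 (∣ X ∣≡ᵇ 2 ∧ X ⊆ᵇ B j)) (λ T → 𝟙 (between 3 X S T))))) ⟩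
      ∑ J (λ j → ∑ˢ n (λ X → 𝟙 (∣ X ∣≡ᵇ 2 ∧ X ⊆ᵇ B j) ℕ.* ∑ˢ n (λ T → 𝟙 (between 3 X S T))))
        ≡⟨ ∑-cong J (λ j → trans (∑ˢ-cong n (per-pair j)) (∑-*ˡ (allSubsets n) 2 _)) ⟩
      ∑ J (λ j → 2 ℕ.* ∑ˢ n (λ X → 𝟙 (∣ X ∣≡ᵇ 2 ∧ X ⊆ᵇ B j) ℕ.* 𝟙 (X ⊆ᵇ S)))
        ≡⟨ ∑-*ˡ J 2 _ ⟩
      2 ℕ.* ∑ J (λ j → ∑ˢ n (λ X → 𝟙 (∣ X ∣≡ᵇ 2 ∧ X ⊆ᵇ B j) ℕ.* 𝟙 (X ⊆ᵇ S))) ∎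
      where
      expand : ∀ T j → 𝟙 (∣ T ∣≡ᵇ 3 ∧ T ⊆ᵇ S) ℕ.* (∣ T ∩ B j ∣ C 2)
                     ≡ ∑ˢ n (λ X → 𝟙 (∣ T ∣≡ᵇ 3 ∧ T ⊆ᵇ S) ℕ.* 𝟙 (∣ X ∣≡ᵇ 2 ∧ (X ⊆ᵇ T ∧ X ⊆ᵇ B j)))
      expand T j = begin
        𝟙 (∣ T ∣≡ᵇ 3 ∧ T ⊆ᵇ S) ℕ.* (∣ T ∩ B j ∣ C 2)
          ≡⟨ cong (𝟙 (∣ T ∣≡ᵇ 3 ∧ T ⊆ᵇ S) ℕ.*_) (sym (#subsets n (T ∩ B j) 2)) ⟩
        𝟙 (∣ T ∣≡ᵇ 3 ∧ T ⊆ᵇ S) ℕ.* ∑ˢ n (λ X → 𝟙 (∣ X ∣≡ᵇ 2 ∧ X ⊆ᵇ (T ∩ B j)))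
          ≡⟨ sym (∑-*ˡ (allSubsets n) (𝟙 (∣ T ∣≡ᵇ 3 ∧ T ⊆ᵇ S)) (λ X → 𝟙 (∣ X ∣≡ᵇ 2 ∧ X ⊆ᵇ (T ∩ B j)))) ⟩
        ∑ˢ n (λ X → 𝟙 (∣ T ∣≡ᵇ 3 ∧ T ⊆ᵇ S) ℕ.* 𝟙 (∣ X ∣≡ᵇ 2 ∧ X ⊆ᵇ (T ∩ B j)))
          ≡⟨ ∑ˢ-cong n (λ X → cong (λ b → 𝟙 (∣ T ∣≡ᵇ 3 ∧ T ⊆ᵇ S) ℕ.* 𝟙 (∣ X ∣≡ᵇ 2 ∧ b)) (⊆ᵇ-∩ X T (B j))) ⟩
        ∑ˢ n (λ X → 𝟙 (∣ T ∣≡ᵇ 3 ∧ T ⊆ᵇ S) ℕ.* 𝟙 (∣ X ∣≡ᵇ 2 ∧ (X ⊆ᵇ T ∧ X ⊆ᵇ B j))) ∎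

-- Binary digits

double : ℕ → ℕ
double zero = zero
double (suc t) = suc (suc (double t))

bit : ℕ → ℕ → Bool
bit zero t = isOdd t
bit (suc j) t = bit j ℕ.⌊ t /2⌋

⌊double/2⌋ : ∀ t → ℕ.⌊ double t /2⌋ ≡ t
⌊double/2⌋ zero = refl
⌊double/2⌋ (suc t) = cong suc (⌊double/2⌋ t)

⌊1+double/2⌋ : ∀ t → ℕ.⌊ suc (double t) /2⌋ ≡ t
⌊1+double/2⌋ zero = refl
⌊1+double/2⌋ (suc t) = cong suc (⌊1+double/2⌋ t)

isOdd-double : ∀ t → isOdd (double t) ≡ false
isOdd-double zero = refl
isOdd-double (suc t) rewrite isOdd-double t = refl

isOdd-1+double : ∀ t → isOdd (suc (double t)) ≡ true
isOdd-1+double t rewrite isOdd-double t = refl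

double≡m+m : ∀ t → double t ≡ t ℕ.+ t
double≡m+m zero = refl
double≡m+m (suc t) = cong suc (trans (cong suc (double≡m+m t)) (sym (+-suc t t)))

even-or-odd : ∀ n → Σ ℕ (λ m → (n ≡ double m) ⊎ (n ≡ suc (double m)))
even-or-odd zero = 0 , inj₁ refl
even-or-odd (suc n) with even-or-odd n
... | m , inj₁ e = m , inj₂ (cong suc e)
... | m , inj₂ e = suc m , inj₁ (cong suc e)

count : (ℕ → Bool) → ℕ → ℕ
count F n = ∑ (List.upTo n) (λ t → 𝟙 (F t))

count-suc : (F : ℕ → Bool) (n : ℕ) → count F (suc n) ≡ count F n ℕ.+ 𝟙 (F n)
count-suc F n = ∑-upTo-snoc n (λ t → 𝟙 (F t))

count-cong : {F F′ : ℕ → Bool} → (∀ t → F t ≡ F′ t) → ∀ n → count F n ≡ count F′ n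
count-cong eq n = ∑-cong (List.upTo n) (λ t → cong 𝟙 (eq t))

count-true : ∀ n → count (λ _ → true) n ≡ n
count-true n = trans (∑-const (List.upTo n) 1) (trans (*-identityˡ _) (List.length-upTo n))
  where import Data.List.Properties as List

count-false : ∀ n → count (λ _ → false) n ≡ 0
count-false n = ∑-zero (List.upTo n) (λ _ → refl)

count+count-not : (F : ℕ → Bool) (m : ℕ) → count F m ℕ.+ count (λ t → not (F t)) m ≡ m
count+count-not F m = begin
  count F m ℕ.+ count (λ t → not (F t)) m   ≡⟨ ∑-partition (List.upTo m) (λ _ → true) F ⟩
  count (λ _ → true) m                      ≡⟨ count-true m ⟩
  m                                         ∎
  where open ≡-Reasoning

count-double : (F : ℕ → Bool) (m : ℕ) →
  count F (double m) ≡ count (λ t → F (double t)) m ℕ.+ count (λ t → F (suc (double t))) m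
count-double F zero = refl
count-double F (suc m) = begin
  count F (suc (suc (double m)))
    ≡⟨ trans (count-suc F (suc (double m))) (cong (ℕ._+ 𝟙 (F (suc (double m)))) (count-suc F (double m))) ⟩
  count F (double m) ℕ.+ 𝟙 (F (double m)) ℕ.+ 𝟙 (F (suc (double m)))
    ≡⟨ cong (λ c → c ℕ.+ 𝟙 (F (double m)) ℕ.+ 𝟙 (F (suc (double m)))) (count-double F m) ⟩
  count Fₑ m ℕ.+ count Fₒ m ℕ.+ 𝟙 (F (double m)) ℕ.+ 𝟙 (F (suc (double m)))
    ≡⟨ shuffle (count Fₑ m) (count Fₒ m) (𝟙 (F (double m))) (𝟙 (F (suc (double m)))) ⟩
  (count Fₑ m ℕ.+ 𝟙 (Fₑ m)) ℕ.+ (count Fₒ m ℕ.+ 𝟙 (Fₒ m))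
    ≡⟨ sym (cong₂ ℕ._+_ (count-suc Fₑ m) (count-suc Fₒ m)) ⟩
  count Fₑ (suc m) ℕ.+ count Fₒ (suc m) ∎
  where
  open ≡-Reasoning
  Fₑ Fₒ : ℕ → Bool
  Fₑ t = F (double t)
  Fₒ t = F (suc (double t))
  shuffle : ∀ a b c d → a ℕ.+ b ℕ.+ c ℕ.+ d ≡ (a ℕ.+ c) ℕ.+ (b ℕ.+ d)
  shuffle = solve-∀

count-1+double : (F : ℕ → Bool) (m : ℕ) →
  count F (suc (double m)) ≡ count (λ t → F (double t)) (suc m) ℕ.+ count (λ t → F (suc (double t))) m
count-1+double F m = begin
  count F (suc (double m))                                    ≡⟨ count-suc F (double m) ⟩
  count F (double m) ℕ.+ 𝟙 (F (double m))                     ≡⟨ cong (ℕ._+ 𝟙 (F (double m))) (count-double F m) ⟩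
  count Fₑ m ℕ.+ count Fₒ m ℕ.+ 𝟙 (F (double m))              ≡⟨ shuffle (count Fₑ m) (count Fₒ m) (𝟙 (F (double m))) ⟩
  count Fₑ m ℕ.+ 𝟙 (F (double m)) ℕ.+ count Fₒ m              ≡⟨ cong (ℕ._+ count Fₒ m) (sym (count-suc Fₑ m)) ⟩
  count Fₑ (suc m) ℕ.+ count Fₒ m                             ∎
  where
  open ≡-Reasoning
  Fₑ Fₒ : ℕ → Bool
  Fₑ t = F (double t)
  Fₒ t = F (suc (double t))
  shuffle : ∀ a b c → a ℕ.+ b ℕ.+ c ≡ (a ℕ.+ c) ℕ.+ b
  shuffle = solve-∀

-- Flips j F: changing binary digit j of the argument negates the value of F.
Flips : ℕ → (ℕ → Bool) → Set
Flips zero F = ∀ t → F (suc (double t)) ≡ not (F (double t))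
Flips (suc j) F = Flips j (λ t → F (double t)) × Flips j (λ t → F (suc (double t)))

Flips-cong : ∀ j {F F′ : ℕ → Bool} → (∀ t → F t ≡ F′ t) → Flips j F → Flips j F′
Flips-cong zero eq fl t = trans (sym (eq (suc (double t)))) (trans (fl t) (cong not (eq (double t))))
Flips-cong (suc j) eq (fl₁ , fl₂) = Flips-cong j (λ t → eq (double t)) fl₁ , Flips-cong j (λ t → eq (suc (double t))) fl₂

record NearHalf (b n c : ℕ) : Set where
  constructor nearHalf
  field
    upper : 2 ℕ.* c ℕ.≤ b ℕ.+ n
    lower : n ℕ.≤ b ℕ.+ 2 ℕ.* c

NearHalf-+ : ∀ {b n₁ n₂ c₁ c₂} → NearHalf b n₁ c₁ → NearHalf b n₂ c₂ → NearHalf (2 ℕ.* b) (n₁ ℕ.+ n₂) (c₁ ℕ.+ c₂)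
NearHalf-+ {b} {n₁} {n₂} {c₁} {c₂} (nearHalf u₁ l₁) (nearHalf u₂ l₂) = nearHalf
  (subst₂ ℕ._≤_ (sym (*-distribˡ-+ 2 c₁ c₂)) (shuffle b n₁ n₂) (+-mono-≤ u₁ u₂))
  (subst (n₁ ℕ.+ n₂ ℕ.≤_) (shuffle b (2 ℕ.* c₁) (2 ℕ.* c₂) ⟨ trans ⟩ cong (2 ℕ.* b ℕ.+_) (sym (*-distribˡ-+ 2 c₁ c₂)))
    (+-mono-≤ l₁ l₂))
  where
  shuffle : ∀ b x y → b ℕ.+ x ℕ.+ (b ℕ.+ y) ≡ 2 ℕ.* b ℕ.+ (x ℕ.+ y)
  shuffle = solve-∀

NearHalf-by-1 : ∀ {n c} → 2 ℕ.* c ℕ.≤ suc n → n ℕ.≤ suc (2 ℕ.* c) → NearHalf 2 n c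
NearHalf-by-1 u l = nearHalf (≤-trans u (n≤1+n _)) (≤-trans l (n≤1+n _))

double≡2* : ∀ t → double t ≡ 2 ℕ.* t
double≡2* t = trans (double≡m+m t) (cong (t ℕ.+_) (sym (+-identityʳ t)))

Flips₀-count-double : ∀ F m → Flips 0 F → count F (double m) ≡ m
Flips₀-count-double F m fl =
  trans (count-double F m) (trans (cong (count (λ t → F (double t)) m ℕ.+_) (count-cong fl m))
    (count+count-not (λ t → F (double t)) m))

Flips₀-count-1+double : ∀ F m → Flips 0 F → count F (suc (double m)) ≡ m ℕ.+ 𝟙 (F (double m))
Flips₀-count-1+double F m fl = begin
  count F (suc (double m))                                   ≡⟨ count-1+double F m ⟩
  count Fₑ (suc m) ℕ.+ count Fₒ m                            ≡⟨ cong₂ ℕ._+_ (count-suc Fₑ m) (count-cong fl m) ⟩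
  count Fₑ m ℕ.+ 𝟙 (Fₑ m) ℕ.+ count (λ t → not (Fₑ t)) m    ≡⟨ shuffle (count Fₑ m) (𝟙 (Fₑ m)) _ ⟩
  count Fₑ m ℕ.+ count (λ t → not (Fₑ t)) m ℕ.+ 𝟙 (Fₑ m)    ≡⟨ cong (ℕ._+ 𝟙 (Fₑ m)) (count+count-not Fₑ m) ⟩
  m ℕ.+ 𝟙 (F (double m))                                     ∎
  where
  open ≡-Reasoning
  Fₑ Fₒ : ℕ → Bool
  Fₑ t = F (double t)
  Fₒ t = F (suc (double t))
  shuffle : ∀ a b c → a ℕ.+ b ℕ.+ c ≡ a ℕ.+ c ℕ.+ b
  shuffle = solve-∀

count-Flips : ∀ j F n → Flips j F → NearHalf (2 ^ suc j) n (count F n)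
count-Flips zero F n fl with even-or-odd n
... | m , inj₁ refl = subst (NearHalf 2 (double m)) (sym (Flips₀-count-double F m fl))
  (NearHalf-by-1 (≤-trans (≤-reflexive (sym (double≡2* m))) (n≤1+n _)) (≤-trans (≤-reflexive (double≡2* m)) (n≤1+n _)))
... | m , inj₂ refl = subst (NearHalf 2 (suc (double m))) (sym (Flips₀-count-1+double F m fl))
  (NearHalf-by-1 upper lower)
  where
  x = 𝟙 (F (double m))
  x≤1 : x ℕ.≤ 1
  x≤1 with F (double m)
  ... | true = ≤-refl
  ... | false = z≤n
  upper : 2 ℕ.* (m ℕ.+ x) ℕ.≤ suc (suc (double m))
  upper = subst (2 ℕ.* (m ℕ.+ x) ℕ.≤_) (trans (*-distribˡ-+ 2 m 1) (cong (ℕ._+ 2) (sym (double≡2* m)) ⟨ trans ⟩ +-comm (double m) 2))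
            (*-monoʳ-≤ 2 (+-monoʳ-≤ m x≤1))
  lower : suc (double m) ℕ.≤ suc (2 ℕ.* (m ℕ.+ x))
  lower = s≤s (subst (ℕ._≤ 2 ℕ.* (m ℕ.+ x)) (sym (double≡2* m)) (*-monoʳ-≤ 2 (m≤m+n m x)))
count-Flips (suc j) F n (fl₁ , fl₂) with even-or-odd n
... | m , inj₁ refl = subst₂ (NearHalf (2 ^ suc (suc j))) (sym (double≡m+m m)) (sym (count-double F m))
  (NearHalf-+ (count-Flips j _ m fl₁) (count-Flips j _ m fl₂))
... | m , inj₂ refl = subst₂ (NearHalf (2 ^ suc (suc j))) (cong suc (sym (double≡m+m m))) (sym (count-1+double F m))
  (NearHalf-+ (count-Flips j _ (suc m) fl₁) (count-Flips j _ m fl₂))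

affine : ℕ → (ℕ → ℕ) → ℕ → ℕ → Bool
affine a m k t = isOdd (a ℕ.+ ∑ (List.upTo k) (λ j → m j ℕ.* 𝟙 (bit j t)))

affine-double : ∀ a m k t → affine a m (suc k) (double t) ≡ affine a (λ j → m (suc j)) k t
affine-double a m k t
  rewrite ∑-upTo-suc k (λ j → m j ℕ.* 𝟙 (bit j (double t))) | isOdd-double t | *-zeroʳ (m 0) | ⌊double/2⌋ t = refl

affine-1+double : ∀ a m k t → affine a m (suc k) (suc (double t)) ≡ affine (a ℕ.+ m 0) (λ j → m (suc j)) k t
affine-1+double a m k t
  rewrite ∑-upTo-suc k (λ j → m j ℕ.* 𝟙 (bit j (suc (double t)))) | isOdd-1+double t | *-identityʳ (m 0)
        | ⌊1+double/2⌋ t = cong isOdd (sym (+-assoc a (m 0) _))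

affine-Flips : ∀ j k a (m : ℕ → ℕ) → j ℕ.< k → isOdd (m j) ≡ true → Flips j (affine a m k)
affine-Flips zero (suc k) a m _ odd t = begin
  affine a m (suc k) (suc (double t))                 ≡⟨ affine-1+double a m k t ⟩
  isOdd (a ℕ.+ m 0 ℕ.+ R)                             ≡⟨ trans (isOdd-+ (a ℕ.+ m 0) R) (cong (_xor isOdd R) (isOdd-+ a (m 0))) ⟩
  (isOdd a xor isOdd (m 0)) xor isOdd R               ≡⟨ cong (λ b → (isOdd a xor b) xor isOdd R) odd ⟩
  (isOdd a xor true) xor isOdd R                      ≡⟨ flip (isOdd a) (isOdd R) ⟩
  not (isOdd a xor isOdd R)                           ≡⟨ cong not (sym (isOdd-+ a R)) ⟩
  not (affine a (λ j → m (suc j)) k t)                ≡⟨ cong not (sym (affine-double a m k t)) ⟩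
  not (affine a m (suc k) (double t))                 ∎
  where
  open ≡-Reasoning
  R = ∑ (List.upTo k) (λ j → m (suc j) ℕ.* 𝟙 (bit j t))
  flip : ∀ x r → (x xor true) xor r ≡ not (x xor r)
  flip false r = refl
  flip true r = sym (BoolP.not-involutive r)
affine-Flips (suc j) (suc k) a m (s≤s j<k) odd =
  Flips-cong j (λ t → sym (affine-double a m k t)) (affine-Flips j k a (λ i → m (suc i)) j<k odd) ,
  Flips-cong j (λ t → sym (affine-1+double a m k t)) (affine-Flips j k (a ℕ.+ m 0) (λ i → m (suc i)) j<k odd)

agree : ℕ → ℕ → ℕ → Bool
agree zero t₀ t = true
agree (suc k) t₀ t = not (isOdd t xor isOdd t₀) ∧ agree k ℕ.⌊ t₀ /2⌋ ℕ.⌊ t /2⌋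

agree-double : ∀ k t₀ {b} → isOdd t₀ ≡ b → ∀ t → agree (suc k) t₀ (double t) ≡ (not (false xor b) ∧ agree k ℕ.⌊ t₀ /2⌋ t)
agree-double k t₀ refl t rewrite isOdd-double t | ⌊double/2⌋ t = refl

agree-1+double : ∀ k t₀ {b} → isOdd t₀ ≡ b → ∀ t → agree (suc k) t₀ (suc (double t)) ≡ (not (true xor b) ∧ agree k ℕ.⌊ t₀ /2⌋ t)
agree-1+double k t₀ refl t rewrite isOdd-1+double t | ⌊1+double/2⌋ t = refl

-- Only the vertices of one residue class modulo 2 can agree with t₀ in the lowest digit.
count-agree-halves : ∀ k t₀ n → Σ ℕ λ m → (2 ℕ.* m ℕ.≤ suc n) × (count (agree (suc k) t₀) n ≡ count (agree k ℕ.⌊ t₀ /2⌋) m)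
count-agree-halves k t₀ n = halves (isOdd t₀) refl (even-or-odd n)
  where
  F = agree (suc k) t₀
  halves : ∀ b → isOdd t₀ ≡ b → Σ ℕ (λ m → (n ≡ double m) ⊎ (n ≡ suc (double m))) →
    Σ ℕ λ m → (2 ℕ.* m ℕ.≤ suc n) × (count F n ≡ count (agree k ℕ.⌊ t₀ /2⌋) m)
  halves false even (m , inj₁ refl) = m , ≤-trans (≤-reflexive (sym (double≡2* m))) (n≤1+n _) ,
    trans (count-double F m) (trans (cong₂ ℕ._+_ (count-cong (agree-double k t₀ even) m)
      (trans (count-cong (agree-1+double k t₀ even) m) (count-false m))) (+-identityʳ _))
  halves false even (m , inj₂ refl) = suc m , ≤-reflexive (trans (*-suc 2 m) (cong (2 ℕ.+_) (sym (double≡2* m)))) ,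
    trans (count-1+double F m) (trans (cong₂ ℕ._+_ (count-cong (agree-double k t₀ even) (suc m))
      (trans (count-cong (agree-1+double k t₀ even) m) (count-false m))) (+-identityʳ _))
  halves true odd (m , inj₁ refl) = m , ≤-trans (≤-reflexive (sym (double≡2* m))) (n≤1+n _) ,
    trans (count-double F m) (cong₂ ℕ._+_ (trans (count-cong (agree-double k t₀ odd) m) (count-false m))
      (count-cong (agree-1+double k t₀ odd) m))
  halves true odd (m , inj₂ refl) = m , ≤-trans (≤-reflexive (sym (double≡2* m))) (≤-trans (n≤1+n _) (n≤1+n _)) ,
    trans (count-1+double F m) (cong₂ ℕ._+_ (trans (count-cong (agree-double k t₀ odd) (suc m)) (count-false (suc m)))
      (count-cong (agree-1+double k t₀ odd) m))

count-agree : ∀ k t₀ n → suc (2 ^ k ℕ.* count (agree k t₀) n) ℕ.≤ n ℕ.+ 2 ^ k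
count-agree zero t₀ n = ≤-reflexive (trans (cong suc (trans (*-identityˡ _) (count-true n))) (+-comm 1 n))
count-agree (suc k) t₀ n with count-agree-halves k t₀ n
... | m , 2m≤1+n , eq rewrite eq = ℕ.s≤s⁻¹ (begin
  suc (suc (2 ℕ.* Q ℕ.* c))    ≡⟨ cong (λ x → suc (suc x)) (*-assoc 2 Q c) ⟩
  suc (suc (2 ℕ.* (Q ℕ.* c)))  ≡⟨ cong suc (sym (+-suc (Q ℕ.* c) (Q ℕ.* c ℕ.+ 0))) ⟩
  2 ℕ.* suc (Q ℕ.* c)          ≤⟨ *-monoʳ-≤ 2 (count-agree k ℕ.⌊ t₀ /2⌋ m) ⟩
  2 ℕ.* (m ℕ.+ Q)              ≡⟨ *-distribˡ-+ 2 m Q ⟩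
  2 ℕ.* m ℕ.+ 2 ℕ.* Q          ≤⟨ +-monoˡ-≤ (2 ℕ.* Q) 2m≤1+n ⟩
  suc n ℕ.+ 2 ℕ.* Q            ∎)
  where
  open ≤-Reasoning
  Q = 2 ^ k
  c = count (agree k ℕ.⌊ t₀ /2⌋) m

someOdd : (ℕ → ℕ) → ℕ → Bool
someOdd m zero = false
someOdd m (suc k) = isOdd (m 0) ∨ someOdd (λ j → m (suc j)) k

someOdd-witness : ∀ m k → someOdd m k ≡ true → Σ ℕ (λ j → (j ℕ.< k) × (isOdd (m j) ≡ true))
someOdd-witness m (suc k) h with isOdd (m 0) in odd
... | true = 0 , s≤s z≤n , odd
... | false with someOdd-witness (λ j → m (suc j)) k h
...   | j , j<k , odd′ = suc j , s≤s j<k , odd′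

someOdd-false : ∀ m k → someOdd m k ≡ false → ∀ j → j ℕ.< k → isOdd (m j) ≡ false
someOdd-false m (suc k) h j j<k with isOdd (m 0) in odd
someOdd-false m (suc k) () j j<k | true
someOdd-false m (suc k) h zero j<k | false = odd
someOdd-false m (suc k) h (suc j) (s≤s j<k) | false = someOdd-false (λ j → m (suc j)) k h j j<k

same-bits⇒agree : ∀ k t₀ t → (∀ j → j ℕ.< k → bit j t ≡ bit j t₀) → agree k t₀ t ≡ true
same-bits⇒agree zero t₀ t h = refl
same-bits⇒agree (suc k) t₀ t h rewrite h 0 (s≤s z≤n) | xor-same (isOdd t₀) =
  same-bits⇒agree k ℕ.⌊ t₀ /2⌋ ℕ.⌊ t /2⌋ (λ j j<k → h (suc j) (s≤s j<k))

even-𝟙+𝟙⇒≡ : ∀ a b → isOdd (𝟙 a ℕ.+ 𝟙 b) ≡ false → a ≡ b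
even-𝟙+𝟙⇒≡ false false h = refl
even-𝟙+𝟙⇒≡ true true h = refl

[m+𝟙b]C2 : ∀ m b → (m ℕ.+ 𝟙 b) C 2 ≡ m C 2 ℕ.+ m ℕ.* 𝟙 b
[m+𝟙b]C2 m false rewrite +-identityʳ m | *-zeroʳ m | +-identityʳ (m C 2) = refl
[m+𝟙b]C2 m true = begin
  (m ℕ.+ 1) C 2          ≡⟨ cong (_C 2) (+-comm m 1) ⟩
  suc m C 2              ≡⟨ sym (nCk+nC[k+1]≡[n+1]C[k+1] m 1) ⟩
  m C 1 ℕ.+ m C 2        ≡⟨ cong (ℕ._+ m C 2) (nC1≡n m) ⟩
  m ℕ.+ m C 2            ≡⟨ +-comm m _ ⟩
  m C 2 ℕ.+ m            ≡⟨ cong (m C 2 ℕ.+_) (sym (*-identityʳ m)) ⟩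
  m C 2 ℕ.+ m ℕ.* 1      ∎
  where open ≡-Reasoning

-- Vertex t is labelled by its lowest k binary digits, so sharedPairs T is the sum of the inner products of the
-- labels of the three pairs in T.
module Construction (n k : ℕ) where

  bitClass : ℕ → Subset n
  bitClass j = tabulate (λ z → bit j (toℕ z))

  open ParityGraph (List.upTo k) bitClass public
  open Counting G public

  ones : Subset n → ℕ → ℕ
  ones X j = ∣ X ∩ bitClass j ∣

  -- Whether X ∪ ⁅ z ⁆ is an edge is an affine function of the digits of z.
  completes : Subset n → ℕ → Bool
  completes X = affine (sharedPairs X) (ones X) k

  sharedPairs-∪⁅⁆ : (X : Subset n) (z : Fin n) → lookup X z ≡ false →
    sharedPairs (X ∪ ⁅ z ⁆) ≡ sharedPairs X ℕ.+ ∑ (List.upTo k) (λ j → ones X j ℕ.* 𝟙 (bit j (toℕ z)))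
  sharedPairs-∪⁅⁆ X z z∉X = trans (∑-cong (List.upTo k) term) (∑-+ (List.upTo k) _ _)
    where
    term : ∀ j → ∣ (X ∪ ⁅ z ⁆) ∩ bitClass j ∣ C 2 ≡ ones X j C 2 ℕ.+ ones X j ℕ.* 𝟙 (bit j (toℕ z))
    term j = trans (cong (_C 2) (trans (∣∪⁅⁆∩∣ X (bitClass j) z z∉X)
                     (cong (λ b → ones X j ℕ.+ 𝟙 b) (lookup∘tabulate (λ z → bit j (toℕ z)) z))))
               ([m+𝟙b]C2 (ones X j) (bit j (toℕ z)))

  codegree≡∑-completes : (X : Subset n) → ∣ X ∣≡ᵇ 2 ≡ true →
    codegree X ≡ ∑ (List.allFin n) (λ z → 𝟙 (not (lookup X z)) ℕ.* 𝟙 (completes X (toℕ z)))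
  codegree≡∑-completes X h = begin
    codegree X
      ≡⟨ ∑ˢ-cong n (λ T → trans (𝟙-∧ (tripleOver X T) (E T))
           (cong (λ m → 𝟙 ((∣ T ∣ ≡ᵇ m) ∧ X ⊆ᵇ T) ℕ.* 𝟙 (E T)) (sym (cong suc (≡ᵇ-sound ∣ X ∣ 2 h))))) ⟩
    ∑ˢ n (λ T → 𝟙 (∣ T ∣≡ᵇ suc ∣ X ∣ ∧ X ⊆ᵇ T) ℕ.* 𝟙 (E T))
      ≡⟨ ∑-one-point-extensions n X (λ T → 𝟙 (E T)) ⟩
    ∑ (List.allFin n) (λ z → 𝟙 (not (lookup X z)) ℕ.* 𝟙 (E (X ∪ ⁅ z ⁆)))
      ≡⟨ ∑-cong (List.allFin n) term ⟩
    ∑ (List.allFin n) (λ z → 𝟙 (not (lookup X z)) ℕ.* 𝟙 (completes X (toℕ z))) ∎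
    where
    open ≡-Reasoning
    term : ∀ z → 𝟙 (not (lookup X z)) ℕ.* 𝟙 (E (X ∪ ⁅ z ⁆)) ≡ 𝟙 (not (lookup X z)) ℕ.* 𝟙 (completes X (toℕ z))
    term z with lookup X z in z∈X
    ... | true = refl
    ... | false = cong (λ q → 1 ℕ.* 𝟙 (isOdd q)) (sharedPairs-∪⁅⁆ X z z∈X)

  codegree≤count-completes : (X : Subset n) → ∣ X ∣≡ᵇ 2 ≡ true → codegree X ℕ.≤ count (completes X) n
  codegree≤count-completes X h = begin
    codegree X                                                                        ≡⟨ codegree≡∑-completes X h ⟩
    ∑ (List.allFin n) (λ z → 𝟙 (not (lookup X z)) ℕ.* 𝟙 (completes X (toℕ z)))       ≤⟨ ∑-mono-≤ (List.allFin n) (λ z → term (lookup X z) _) ⟩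
    ∑ (List.allFin n) (λ z → 𝟙 (completes X (toℕ z)))                                ≡⟨ ∑-allFin-toℕ n (λ t → 𝟙 (completes X t)) ⟩
    count (completes X) n                                                             ∎
    where
    open ≤-Reasoning
    term : ∀ a b → 𝟙 (not a) ℕ.* 𝟙 b ℕ.≤ 𝟙 b
    term false b = ≤-reflexive (+-identityʳ _)
    term true b = z≤n

  count-completes≤codegree+2 : (X : Subset n) → ∣ X ∣≡ᵇ 2 ≡ true → count (completes X) n ℕ.≤ codegree X ℕ.+ 2
  count-completes≤codegree+2 X h = begin
    count (completes X) n
      ≡⟨ sym (∑-allFin-toℕ n (λ t → 𝟙 (completes X t))) ⟩
    ∑ (List.allFin n) (λ z → 𝟙 (completes X (toℕ z)))
      ≤⟨ ∑-mono-≤ (List.allFin n) (λ z → term (lookup X z) (completes X (toℕ z))) ⟩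
    ∑ (List.allFin n) (λ z → 𝟙 (not (lookup X z)) ℕ.* 𝟙 (completes X (toℕ z)) ℕ.+ 𝟙 (lookup X z))
      ≡⟨ ∑-+ (List.allFin n) _ _ ⟩
    ∑ (List.allFin n) (λ z → 𝟙 (not (lookup X z)) ℕ.* 𝟙 (completes X (toℕ z))) ℕ.+ ∑ (List.allFin n) (λ z → 𝟙 (lookup X z))
      ≡⟨ cong₂ ℕ._+_ (sym (codegree≡∑-completes X h)) (trans (∑-lookup≡∣∣ X) (≡ᵇ-sound ∣ X ∣ 2 h)) ⟩
    codegree X ℕ.+ 2 ∎
    where
    open ≤-Reasoning
    term : ∀ a b → 𝟙 b ℕ.≤ 𝟙 (not a) ℕ.* 𝟙 b ℕ.+ 𝟙 a
    term false b = ≤-reflexive (sym (trans (+-identityʳ _) (+-identityʳ _)))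
    term true false = z≤n
    term true true = ≤-refl

  μ : ℕ
  μ = n ∸ (2 ^ k ℕ.+ 4)

  -- A pair whose labels differ has some digit j where exactly one of its two vertices has a 1, so
  -- completes X flips with digit j and half of the vertices complete X to an edge.
  codegrees-balanced : (X : Subset n) → ∣ X ∣≡ᵇ 2 ≡ true → someOdd (ones X) k ≡ true →
    (μ ℕ.≤ 2 ℕ.* codegree X) × (μ ℕ.≤ 2 ℕ.* nonCodegree X)
  codegrees-balanced X h odd = m≤n+o⇒m∸n≤o n (P ℕ.+ 4) lower-c , m≤n+o⇒m∸n≤o n (P ℕ.+ 4) lower-c′
    where
    open ≤-Reasoning
    P = 2 ^ k
    c = codegree X
    c′ = nonCodegree X
    j = proj₁ (someOdd-witness (ones X) k odd)
    j<k : j ℕ.< k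
    j<k = proj₁ (proj₂ (someOdd-witness (ones X) k odd))
    near : NearHalf P n (count (completes X) n)
    near = record { upper = ≤-trans upper (+-monoˡ-≤ n 2ʲ⁺¹≤P) ; lower = ≤-trans lower (+-monoˡ-≤ _ 2ʲ⁺¹≤P) }
      where
      open NearHalf (count-Flips j (completes X) n (affine-Flips j k (sharedPairs X) (ones X) j<k (proj₂ (proj₂ (someOdd-witness (ones X) k odd)))))
      2ʲ⁺¹≤P : 2 ^ suc j ℕ.≤ P
      2ʲ⁺¹≤P = ^-monoʳ-≤ 2 j<k
    n≡c+c′+2 : n ≡ c ℕ.+ c′ ℕ.+ 2
    n≡c+c′+2 = sym (trans (cong (ℕ._+ 2) (codegree+nonCodegree X h))
                 (m∸n+n≡m (subst (ℕ._≤ n) (≡ᵇ-sound ∣ X ∣ 2 h) (∣S∣≤n X))))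
    lower-c : n ℕ.≤ P ℕ.+ 4 ℕ.+ 2 ℕ.* c
    lower-c = begin
      n                                  ≤⟨ NearHalf.lower near ⟩
      P ℕ.+ 2 ℕ.* count (completes X) n  ≤⟨ +-monoʳ-≤ P (*-monoʳ-≤ 2 (count-completes≤codegree+2 X h)) ⟩
      P ℕ.+ 2 ℕ.* (c ℕ.+ 2)              ≡⟨ e c P ⟩
      P ℕ.+ 4 ℕ.+ 2 ℕ.* c                ∎
      where
      e : ∀ c P → P ℕ.+ 2 ℕ.* (c ℕ.+ 2) ≡ P ℕ.+ 4 ℕ.+ 2 ℕ.* c
      e = solve-∀
    lower-c′ : n ℕ.≤ P ℕ.+ 4 ℕ.+ 2 ℕ.* c′
    lower-c′ = +-cancelˡ-≤ (2 ℕ.* c) _ _ (begin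
      2 ℕ.* c ℕ.+ n                                ≤⟨ +-monoˡ-≤ n (≤-trans (*-monoʳ-≤ 2 (codegree≤count-completes X h)) (NearHalf.upper near)) ⟩
      P ℕ.+ n ℕ.+ n                                ≡⟨ cong (λ m → P ℕ.+ m ℕ.+ m) n≡c+c′+2 ⟩
      P ℕ.+ (c ℕ.+ c′ ℕ.+ 2) ℕ.+ (c ℕ.+ c′ ℕ.+ 2)  ≡⟨ e c c′ P ⟩
      2 ℕ.* c ℕ.+ (P ℕ.+ 4 ℕ.+ 2 ℕ.* c′)           ∎)
      where
      e : ∀ c c′ P → P ℕ.+ (c ℕ.+ c′ ℕ.+ 2) ℕ.+ (c ℕ.+ c′ ℕ.+ 2) ≡ 2 ℕ.* c ℕ.+ (P ℕ.+ 4 ℕ.+ 2 ℕ.* c′)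
      e = solve-∀

  twin : Subset n → Bool
  twin X = not (someOdd (ones X) k)

  #twins : ℕ
  #twins = ∑ˢ n (λ X → 𝟙 (∣ X ∣≡ᵇ 2 ∧ twin X))

  -- Non-twin pairs contribute at least μ²/4 to ∑ codegree · nonCodegree; twin pairs are charged μ².
  C[n,2]μ²≤16e42+#twinsμ² : (n C 2) ℕ.* (μ ℕ.* μ) ℕ.≤ 16 ℕ.* e42 G ℕ.+ #twins ℕ.* (μ ℕ.* μ)
  C[n,2]μ²≤16e42+#twinsμ² = begin
    (n C 2) ℕ.* (μ ℕ.* μ)
      ≡⟨ cong (ℕ._* (μ ℕ.* μ)) (sym #pairs) ⟩
    ∑ˢ n (λ X → 𝟙 (∣ X ∣≡ᵇ 2)) ℕ.* (μ ℕ.* μ)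
      ≡⟨ sym (∑-*ʳ (allSubsets n) (μ ℕ.* μ) _) ⟩
    ∑ˢ n (λ X → 𝟙 (∣ X ∣≡ᵇ 2) ℕ.* (μ ℕ.* μ))
      ≤⟨ ∑-mono-≤ (allSubsets n) pointwise ⟩
    ∑ˢ n (λ X → 4 ℕ.* (𝟙 (∣ X ∣≡ᵇ 2) ℕ.* (codegree X ℕ.* nonCodegree X)) ℕ.+ 𝟙 (∣ X ∣≡ᵇ 2 ∧ twin X) ℕ.* (μ ℕ.* μ))
      ≡⟨ ∑-+ (allSubsets n) _ _ ⟩
    ∑ˢ n (λ X → 4 ℕ.* (𝟙 (∣ X ∣≡ᵇ 2) ℕ.* (codegree X ℕ.* nonCodegree X))) ℕ.+ ∑ˢ n (λ X → 𝟙 (∣ X ∣≡ᵇ 2 ∧ twin X) ℕ.* (μ ℕ.* μ))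
      ≡⟨ cong₂ ℕ._+_ (trans (∑-*ˡ (allSubsets n) 4 _) (cong (4 ℕ.*_) (sym (4e42≡∑-codegrees even))))
                     (∑-*ʳ (allSubsets n) (μ ℕ.* μ) _) ⟩
    4 ℕ.* (4 ℕ.* e42 G) ℕ.+ #twins ℕ.* (μ ℕ.* μ)
      ≡⟨ cong (ℕ._+ #twins ℕ.* (μ ℕ.* μ)) (sym (*-assoc 4 4 (e42 G))) ⟩
    16 ℕ.* e42 G ℕ.+ #twins ℕ.* (μ ℕ.* μ) ∎
    where
    open ≤-Reasoning
    pointwise : (X : Subset n) → 𝟙 (∣ X ∣≡ᵇ 2) ℕ.* (μ ℕ.* μ)
      ℕ.≤ 4 ℕ.* (𝟙 (∣ X ∣≡ᵇ 2) ℕ.* (codegree X ℕ.* nonCodegree X)) ℕ.+ 𝟙 (∣ X ∣≡ᵇ 2 ∧ twin X) ℕ.* (μ ℕ.* μ)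
    pointwise X with ∣ X ∣≡ᵇ 2 in h | someOdd (ones X) k in odd
    ... | false | _ = z≤n
    ... | true | false = m≤n+m ((μ ℕ.* μ) ℕ.+ 0) (4 ℕ.* ((codegree X ℕ.* nonCodegree X) ℕ.+ 0))
    ... | true | true = ≤-trans (≤-reflexive (+-identityʳ _))
        (≤-trans (*-mono-≤ (proj₁ balanced) (proj₂ balanced)) (≤-trans (≤-reflexive (e (codegree X) (nonCodegree X))) (m≤m+n _ _)))
      where
      balanced : (μ ℕ.≤ 2 ℕ.* codegree X) × (μ ℕ.≤ 2 ℕ.* nonCodegree X)
      balanced = codegrees-balanced X h odd
      e : ∀ a b → 2 ℕ.* a ℕ.* (2 ℕ.* b) ≡ 4 ℕ.* ((a ℕ.* b) ℕ.+ 0)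
      e = solve-∀

  twin⇒agree : (x z : Fin n) → 𝟙 (not (lookup ⁅ x ⁆ z)) ℕ.* 𝟙 (twin (⁅ x ⁆ ∪ ⁅ z ⁆)) ℕ.≤ 𝟙 (agree k (toℕ x) (toℕ z))
  twin⇒agree x z with lookup ⁅ x ⁆ z in z∉⁅x⁆ | someOdd (ones (⁅ x ⁆ ∪ ⁅ z ⁆)) k in odd
  ... | true | _ = z≤n
  ... | false | true = z≤n
  ... | false | false = ≤-reflexive (cong 𝟙 (sym (same-bits⇒agree k (toℕ x) (toℕ z) same)))
    where
    same : ∀ j → j ℕ.< k → bit j (toℕ z) ≡ bit j (toℕ x)
    same j j<k = sym (even-𝟙+𝟙⇒≡ _ _ (trans (cong isOdd (sym ones≡)) (someOdd-false (ones (⁅ x ⁆ ∪ ⁅ z ⁆)) k odd j j<k)))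
      where
      ones≡ : ones (⁅ x ⁆ ∪ ⁅ z ⁆) j ≡ 𝟙 (bit j (toℕ x)) ℕ.+ 𝟙 (bit j (toℕ z))
      ones≡ = trans (∣∪⁅⁆∩∣ ⁅ x ⁆ (bitClass j) z z∉⁅x⁆)
        (cong₂ ℕ._+_ (trans (∣⁅⁆∩∣ (bitClass j) x) (cong 𝟙 (lookup∘tabulate (λ z → bit j (toℕ z)) x)))
                     (cong 𝟙 (lookup∘tabulate (λ z → bit j (toℕ z)) z)))

  -- Twins agree in all k digits, and each vertex agrees with only about n / 2ᵏ vertices.
  2ᵏ·2#twins≤n[n+2ᵏ] : 2 ^ k ℕ.* (2 ℕ.* #twins) ℕ.≤ n ℕ.* (n ℕ.+ 2 ^ k)
  2ᵏ·2#twins≤n[n+2ᵏ] = begin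
    P ℕ.* (2 ℕ.* #twins)                                           ≤⟨ *-monoʳ-≤ P ordered-twins ⟩
    P ℕ.* ∑ (List.allFin n) (λ x → count (agree k (toℕ x)) n)      ≡⟨ sym (∑-*ˡ (List.allFin n) P _) ⟩
    ∑ (List.allFin n) (λ x → P ℕ.* count (agree k (toℕ x)) n)      ≤⟨ ∑-mono-≤ (List.allFin n) (λ x → ≤-trans (n≤1+n _) (count-agree k (toℕ x) n)) ⟩
    ∑ (List.allFin n) (λ x → n ℕ.+ P)                              ≡⟨ ∑-const (List.allFin n) (n ℕ.+ P) ⟩
    (n ℕ.+ P) ℕ.* length (List.allFin n)                           ≡⟨ cong ((n ℕ.+ P) ℕ.*_) (length-tabulate id) ⟩
    (n ℕ.+ P) ℕ.* n                                                ≡⟨ *-comm (n ℕ.+ P) n ⟩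
    n ℕ.* (n ℕ.+ P)                                                ∎
    where
    open ≤-Reasoning
    P = 2 ^ k
    w : Subset n → ℕ
    w Y = 𝟙 (∣ Y ∣≡ᵇ 2 ∧ twin Y)
    double-count : ∀ Y → 2 ℕ.* w Y ≡ w Y ℕ.* ∑ (List.allFin n) (λ x → 𝟙 (lookup Y x))
    double-count Y rewrite ∑-lookup≡∣∣ Y with ∣ Y ∣≡ᵇ 2 in h
    ... | false = refl
    ... | true = trans (*-comm 2 (𝟙 (twin Y))) (cong (𝟙 (twin Y) ℕ.*_) (sym (≡ᵇ-sound ∣ Y ∣ 2 h)))
    regroup : ∀ a b c → 𝟙 (a ∧ b) ℕ.* 𝟙 c ≡ 𝟙 (a ∧ c) ℕ.* 𝟙 b
    regroup a b c rewrite 𝟙-∧ a b | 𝟙-∧ a c = trans (*-assoc (𝟙 a) (𝟙 b) (𝟙 c))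
      (trans (cong (𝟙 a ℕ.*_) (*-comm (𝟙 b) (𝟙 c))) (sym (*-assoc (𝟙 a) (𝟙 c) (𝟙 b))))
    through-x : ∀ x Y → w Y ℕ.* 𝟙 (lookup Y x) ≡ 𝟙 (∣ Y ∣≡ᵇ suc ∣ ⁅ x ⁆ ∣ ∧ ⁅ x ⁆ ⊆ᵇ Y) ℕ.* 𝟙 (twin Y)
    through-x x Y rewrite ∣⁅x⁆∣≡1 x | ⁅⁆-⊆ᵇ x Y = regroup (∣ Y ∣≡ᵇ 2) (twin Y) (lookup Y x)
    ordered-twins : 2 ℕ.* #twins ℕ.≤ ∑ (List.allFin n) (λ x → count (agree k (toℕ x)) n)
    ordered-twins = begin
      2 ℕ.* #twins                                                                 ≡⟨ sym (∑-*ˡ (allSubsets n) 2 w) ⟩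
      ∑ˢ n (λ Y → 2 ℕ.* w Y)                                                       ≡⟨ ∑ˢ-cong n double-count ⟩
      ∑ˢ n (λ Y → w Y ℕ.* ∑ (List.allFin n) (λ x → 𝟙 (lookup Y x)))               ≡⟨ ∑ˢ-cong n (λ Y → sym (∑-*ˡ (List.allFin n) (w Y) _)) ⟩
      ∑ˢ n (λ Y → ∑ (List.allFin n) (λ x → w Y ℕ.* 𝟙 (lookup Y x)))               ≡⟨ ∑-comm (allSubsets n) (List.allFin n) _ ⟩
      ∑ (List.allFin n) (λ x → ∑ˢ n (λ Y → w Y ℕ.* 𝟙 (lookup Y x)))               ≡⟨ ∑-cong (List.allFin n) (λ x → ∑ˢ-cong n (through-x x)) ⟩
      ∑ (List.allFin n) (λ x → ∑ˢ n (λ Y → 𝟙 (∣ Y ∣≡ᵇ suc ∣ ⁅ x ⁆ ∣ ∧ ⁅ x ⁆ ⊆ᵇ Y) ℕ.* 𝟙 (twin Y)))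
        ≡⟨ ∑-cong (List.allFin n) (λ x → ∑-one-point-extensions n ⁅ x ⁆ (λ Y → 𝟙 (twin Y))) ⟩
      ∑ (List.allFin n) (λ x → ∑ (List.allFin n) (λ z → 𝟙 (not (lookup ⁅ x ⁆ z)) ℕ.* 𝟙 (twin (⁅ x ⁆ ∪ ⁅ z ⁆))))
        ≤⟨ ∑-mono-≤ (List.allFin n) (λ x → ∑-mono-≤ (List.allFin n) (twin⇒agree x)) ⟩
      ∑ (List.allFin n) (λ x → ∑ (List.allFin n) (λ z → 𝟙 (agree k (toℕ x) (toℕ z))))
        ≡⟨ ∑-cong (List.allFin n) (λ x → ∑-allFin-toℕ n (λ t → 𝟙 (agree k (toℕ x) t))) ⟩
      ∑ (List.allFin n) (λ x → count (agree k (toℕ x)) n) ∎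

-- Arithmetic

[2+m]C2-formula : ∀ m → 2 ℕ.* ((2 ℕ.+ m) C 2) ≡ (2 ℕ.+ m) ℕ.* (1 ℕ.+ m)
[2+m]C2-formula zero = refl
[2+m]C2-formula (suc m) = begin
  2 ℕ.* (suc (2 ℕ.+ m) C 2) ≡⟨ cong (2 ℕ.*_) (sym (nCk+nC[k+1]≡[n+1]C[k+1] (2 ℕ.+ m) 1)) ⟩
  2 ℕ.* ((2 ℕ.+ m) C 1 ℕ.+ (2 ℕ.+ m) C 2) ≡⟨ *-distribˡ-+ 2 ((2 ℕ.+ m) C 1) _ ⟩
  2 ℕ.* ((2 ℕ.+ m) C 1) ℕ.+ 2 ℕ.* ((2 ℕ.+ m) C 2) ≡⟨ cong₂ (λ a b → 2 ℕ.* a ℕ.+ b) (nC1≡n (2 ℕ.+ m)) ([2+m]C2-formula m) ⟩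
  2 ℕ.* (2 ℕ.+ m) ℕ.+ (2 ℕ.+ m) ℕ.* (1 ℕ.+ m) ≡⟨ ring m ⟩
  (3 ℕ.+ m) ℕ.* (2 ℕ.+ m) ∎
  where
  open ≡-Reasoning
  ring : ∀ m → 2 ℕ.* (2 ℕ.+ m) ℕ.+ (2 ℕ.+ m) ℕ.* (1 ℕ.+ m) ≡ (3 ℕ.+ m) ℕ.* (2 ℕ.+ m)
  ring = solve-∀

[3+m]C3-formula : ∀ m → 6 ℕ.* ((3 ℕ.+ m) C 3) ≡ (3 ℕ.+ m) ℕ.* (2 ℕ.+ m) ℕ.* (1 ℕ.+ m)
[3+m]C3-formula zero = refl
[3+m]C3-formula (suc m) = begin
  6 ℕ.* (suc (3 ℕ.+ m) C 3) ≡⟨ cong (6 ℕ.*_) (sym (nCk+nC[k+1]≡[n+1]C[k+1] (3 ℕ.+ m) 2)) ⟩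
  6 ℕ.* ((3 ℕ.+ m) C 2 ℕ.+ (3 ℕ.+ m) C 3) ≡⟨ split ((3 ℕ.+ m) C 2) _ ⟩
  3 ℕ.* (2 ℕ.* ((2 ℕ.+ suc m) C 2)) ℕ.+ 6 ℕ.* ((3 ℕ.+ m) C 3) ≡⟨ cong₂ (λ a b → 3 ℕ.* a ℕ.+ b) ([2+m]C2-formula (suc m)) ([3+m]C3-formula m) ⟩
  3 ℕ.* ((2 ℕ.+ suc m) ℕ.* (1 ℕ.+ suc m)) ℕ.+ (3 ℕ.+ m) ℕ.* (2 ℕ.+ m) ℕ.* (1 ℕ.+ m) ≡⟨ ring m ⟩
  (4 ℕ.+ m) ℕ.* (3 ℕ.+ m) ℕ.* (2 ℕ.+ m) ∎
  where
  open ≡-Reasoning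
  split : ∀ a b → 6 ℕ.* (a ℕ.+ b) ≡ 3 ℕ.* (2 ℕ.* a) ℕ.+ 6 ℕ.* b
  split = solve-∀
  ring : ∀ m → 3 ℕ.* ((2 ℕ.+ suc m) ℕ.* (1 ℕ.+ suc m)) ℕ.+ (3 ℕ.+ m) ℕ.* (2 ℕ.+ m) ℕ.* (1 ℕ.+ m) ≡ (4 ℕ.+ m) ℕ.* (3 ℕ.+ m) ℕ.* (2 ℕ.+ m)
  ring = solve-∀

[4+m]C4-formula : ∀ m → 24 ℕ.* ((4 ℕ.+ m) C 4) ≡ (4 ℕ.+ m) ℕ.* (3 ℕ.+ m) ℕ.* (2 ℕ.+ m) ℕ.* (1 ℕ.+ m)
[4+m]C4-formula zero = refl
[4+m]C4-formula (suc m) = begin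
  24 ℕ.* (suc (4 ℕ.+ m) C 4) ≡⟨ cong (24 ℕ.*_) (sym (nCk+nC[k+1]≡[n+1]C[k+1] (4 ℕ.+ m) 3)) ⟩
  24 ℕ.* ((4 ℕ.+ m) C 3 ℕ.+ (4 ℕ.+ m) C 4) ≡⟨ split ((4 ℕ.+ m) C 3) _ ⟩
  4 ℕ.* (6 ℕ.* ((3 ℕ.+ suc m) C 3)) ℕ.+ 24 ℕ.* ((4 ℕ.+ m) C 4) ≡⟨ cong₂ (λ a b → 4 ℕ.* a ℕ.+ b) ([3+m]C3-formula (suc m)) ([4+m]C4-formula m) ⟩
  4 ℕ.* ((3 ℕ.+ suc m) ℕ.* (2 ℕ.+ suc m) ℕ.* (1 ℕ.+ suc m)) ℕ.+ (4 ℕ.+ m) ℕ.* (3 ℕ.+ m) ℕ.* (2 ℕ.+ m) ℕ.* (1 ℕ.+ m) ≡⟨ ring m ⟩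
  (5 ℕ.+ m) ℕ.* (4 ℕ.+ m) ℕ.* (3 ℕ.+ m) ℕ.* (2 ℕ.+ m) ∎
  where
  open ≡-Reasoning
  split : ∀ a b → 24 ℕ.* (a ℕ.+ b) ≡ 4 ℕ.* (6 ℕ.* a) ℕ.+ 24 ℕ.* b
  split = solve-∀
  ring : ∀ m → 4 ℕ.* ((3 ℕ.+ suc m) ℕ.* (2 ℕ.+ suc m) ℕ.* (1 ℕ.+ suc m)) ℕ.+ (4 ℕ.+ m) ℕ.* (3 ℕ.+ m) ℕ.* (2 ℕ.+ m) ℕ.* (1 ℕ.+ m) ≡ (5 ℕ.+ m) ℕ.* (4 ℕ.+ m) ℕ.* (3 ℕ.+ m) ℕ.* (2 ℕ.+ m)
  ring = solve-∀

-- (2+m)² C(4+m,2) / 16 = (3/4) C(4+m,4) (2+m)/(1+m), and (2+m)/(1+m) ≤ 1 + 4/(3d) once m ≥ d.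
upper-density : ∀ d m e → d ℕ.≤ m → 16 ℕ.* e ℕ.≤ ((2 ℕ.+ m) ℕ.* (2 ℕ.+ m)) ℕ.* ((4 ℕ.+ m) C 2) →
  e ℕ.* (4 ℕ.* d) ℕ.≤ (3 ℕ.* d ℕ.+ 4) ℕ.* ((4 ℕ.+ m) C 4)
upper-density d m e d≤m 16e≤ = *-cancelˡ-≤ 24 (begin
  24 ℕ.* (e ℕ.* (4 ℕ.* d))                                 ≡⟨ e₁ d e ⟩
  6 ℕ.* d ℕ.* (16 ℕ.* e)                                   ≤⟨ *-monoʳ-≤ (6 ℕ.* d) 16e≤ ⟩
  6 ℕ.* d ℕ.* (((2 ℕ.+ m) ℕ.* (2 ℕ.+ m)) ℕ.* C₂)           ≡⟨ e₂ d m C₂ ⟩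
  3 ℕ.* d ℕ.* (2 ℕ.+ m) ℕ.* (2 ℕ.+ m) ℕ.* (2 ℕ.* C₂)       ≡⟨ cong (3 ℕ.* d ℕ.* (2 ℕ.+ m) ℕ.* (2 ℕ.+ m) ℕ.*_) ([2+m]C2-formula (2 ℕ.+ m)) ⟩
  3 ℕ.* d ℕ.* (2 ℕ.+ m) ℕ.* (2 ℕ.+ m) ℕ.* ((4 ℕ.+ m) ℕ.* (3 ℕ.+ m))   ≡⟨ e₃ d m ⟩
  3 ℕ.* d ℕ.* (2 ℕ.+ m) ℕ.* R                              ≤⟨ *-monoˡ-≤ R key ⟩
  (3 ℕ.* d ℕ.+ 4) ℕ.* (1 ℕ.+ m) ℕ.* R                      ≡⟨ e₄ d m ⟩
  (3 ℕ.* d ℕ.+ 4) ℕ.* ((4 ℕ.+ m) ℕ.* (3 ℕ.+ m) ℕ.* (2 ℕ.+ m) ℕ.* (1 ℕ.+ m))   ≡⟨ cong ((3 ℕ.* d ℕ.+ 4) ℕ.*_) (sym ([4+m]C4-formula m)) ⟩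
  (3 ℕ.* d ℕ.+ 4) ℕ.* (24 ℕ.* C₄)                          ≡⟨ e₅ (3 ℕ.* d ℕ.+ 4) C₄ ⟩
  24 ℕ.* ((3 ℕ.* d ℕ.+ 4) ℕ.* C₄)                          ∎)
  where
  open ≤-Reasoning
  C₂ = (4 ℕ.+ m) C 2
  C₄ = (4 ℕ.+ m) C 4
  R = (2 ℕ.+ m) ℕ.* ((4 ℕ.+ m) ℕ.* (3 ℕ.+ m))
  e₁ : ∀ d e → 24 ℕ.* (e ℕ.* (4 ℕ.* d)) ≡ 6 ℕ.* d ℕ.* (16 ℕ.* e)
  e₁ = solve-∀
  e₂ : ∀ d m C₂ → 6 ℕ.* d ℕ.* (((2 ℕ.+ m) ℕ.* (2 ℕ.+ m)) ℕ.* C₂) ≡ 3 ℕ.* d ℕ.* (2 ℕ.+ m) ℕ.* (2 ℕ.+ m) ℕ.* (2 ℕ.* C₂)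
  e₂ = solve-∀
  e₃ : ∀ d m → 3 ℕ.* d ℕ.* (2 ℕ.+ m) ℕ.* (2 ℕ.+ m) ℕ.* ((4 ℕ.+ m) ℕ.* (3 ℕ.+ m))
             ≡ 3 ℕ.* d ℕ.* (2 ℕ.+ m) ℕ.* ((2 ℕ.+ m) ℕ.* ((4 ℕ.+ m) ℕ.* (3 ℕ.+ m)))
  e₃ = solve-∀
  e₄ : ∀ d m → (3 ℕ.* d ℕ.+ 4) ℕ.* (1 ℕ.+ m) ℕ.* ((2 ℕ.+ m) ℕ.* ((4 ℕ.+ m) ℕ.* (3 ℕ.+ m)))
             ≡ (3 ℕ.* d ℕ.+ 4) ℕ.* ((4 ℕ.+ m) ℕ.* (3 ℕ.+ m) ℕ.* (2 ℕ.+ m) ℕ.* (1 ℕ.+ m))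
  e₄ = solve-∀
  e₅ : ∀ a C → a ℕ.* (24 ℕ.* C) ≡ 24 ℕ.* (a ℕ.* C)
  e₅ = solve-∀
  key : 3 ℕ.* d ℕ.* (2 ℕ.+ m) ℕ.≤ (3 ℕ.* d ℕ.+ 4) ℕ.* (1 ℕ.+ m)
  key with m≤n⇒∃[o]m+o≡n d≤m
  ... | t , refl = subst (3 ℕ.* d ℕ.* (2 ℕ.+ (d ℕ.+ t)) ℕ.≤_) (sym (e₆ d t)) (m≤m+n _ _)
    where
    e₆ : ∀ d t → (3 ℕ.* d ℕ.+ 4) ℕ.* (1 ℕ.+ (d ℕ.+ t)) ≡ 3 ℕ.* d ℕ.* (2 ℕ.+ (d ℕ.+ t)) ℕ.+ (d ℕ.+ 4 ℕ.* t ℕ.+ 4)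
    e₆ = solve-∀

-- With n = 4 + m and m = x + P: the counting bounds of the construction, for μ = x and P = 2ᵏ ≥ 4d,
-- give e ≥ (3/4 - 1/d) C(n,4) once x ≥ P (P + 4).
module LowerDensity (d P x e t : ℕ) (4d≤P : 4 ℕ.* d ℕ.≤ P) (P[P+4]≤x : P ℕ.* (P ℕ.+ 4) ℕ.≤ x)
  (pairs : ((4 ℕ.+ (x ℕ.+ P)) C 2) ℕ.* (x ℕ.* x) ℕ.≤ 16 ℕ.* e ℕ.+ t ℕ.* (x ℕ.* x))
  (twins : P ℕ.* (2 ℕ.* t) ℕ.≤ (4 ℕ.+ (x ℕ.+ P)) ℕ.* ((4 ℕ.+ (x ℕ.+ P)) ℕ.+ P)) where

  private
    m = x ℕ.+ P
    n = 4 ℕ.+ m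
    xx = x ℕ.* x
    B = n ℕ.* (3 ℕ.+ m)
    D = (2 ℕ.+ m) ℕ.* (1 ℕ.+ m)
    A = B ℕ.* D
    R = (2 ℕ.* P ℕ.+ 3) ℕ.* x ℕ.+ (P ℕ.+ 2) ℕ.* (P ℕ.+ 1)
    V = n ℕ.* (n ℕ.+ P) ℕ.* xx

    PBxx≤ : P ℕ.* B ℕ.* xx ℕ.≤ 32 ℕ.* P ℕ.* e ℕ.+ V
    PBxx≤ = begin
      P ℕ.* B ℕ.* xx                          ≡⟨ cong (λ z → P ℕ.* z ℕ.* xx) (sym ([2+m]C2-formula (2 ℕ.+ m))) ⟩
      P ℕ.* (2 ℕ.* (n C 2)) ℕ.* xx            ≡⟨ e₁ P (n C 2) xx ⟩
      2 ℕ.* P ℕ.* ((n C 2) ℕ.* xx)              ≤⟨ *-monoʳ-≤ (2 ℕ.* P) pairs ⟩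
      2 ℕ.* P ℕ.* (16 ℕ.* e ℕ.+ t ℕ.* xx)     ≡⟨ e₂ P e t xx ⟩
      32 ℕ.* P ℕ.* e ℕ.+ P ℕ.* (2 ℕ.* t) ℕ.* xx ≤⟨ +-monoʳ-≤ (32 ℕ.* P ℕ.* e) (*-monoˡ-≤ xx twins) ⟩
      32 ℕ.* P ℕ.* e ℕ.+ V                    ∎
      where
      open ≤-Reasoning
      e₁ : ∀ P C xx → P ℕ.* (2 ℕ.* C) ℕ.* xx ≡ 2 ℕ.* P ℕ.* (C ℕ.* xx)
      e₁ = solve-∀
      e₂ : ∀ P e t xx → 2 ℕ.* P ℕ.* (16 ℕ.* e ℕ.+ t ℕ.* xx) ≡ 32 ℕ.* P ℕ.* e ℕ.+ P ℕ.* (2 ℕ.* t) ℕ.* xx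
      e₂ = solve-∀

    D≡xx+R : D ≡ xx ℕ.+ R
    D≡xx+R = ring x P
      where
      ring : ∀ x P → (2 ℕ.+ (x ℕ.+ P)) ℕ.* (1 ℕ.+ (x ℕ.+ P)) ≡ x ℕ.* x ℕ.+ ((2 ℕ.* P ℕ.+ 3) ℕ.* x ℕ.+ (P ℕ.+ 2) ℕ.* (P ℕ.+ 1))
      ring = solve-∀

    V≤2BD : V ℕ.≤ 2 ℕ.* B ℕ.* D
    V≤2BD = begin
      n ℕ.* (n ℕ.+ P) ℕ.* xx           ≤⟨ *-mono-≤ (*-monoʳ-≤ n n+P≤) (*-mono-≤ (x≤ 2) (x≤ 1)) ⟩
      n ℕ.* (2 ℕ.* (3 ℕ.+ m)) ℕ.* D    ≡⟨ ring n (3 ℕ.+ m) D ⟩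
      2 ℕ.* B ℕ.* D                    ∎
      where
      open ≤-Reasoning
      x≤ : ∀ c → x ℕ.≤ c ℕ.+ m
      x≤ c = ≤-trans (m≤m+n x P) (m≤n+m m c)
      n+P≤ : n ℕ.+ P ℕ.≤ 2 ℕ.* (3 ℕ.+ m)
      n+P≤ = subst (n ℕ.+ P ℕ.≤_) (sym (e′ x P)) (m≤m+n _ _)
        where
        e′ : ∀ x P → 2 ℕ.* (3 ℕ.+ (x ℕ.+ P)) ≡ (4 ℕ.+ (x ℕ.+ P) ℕ.+ P) ℕ.+ (x ℕ.+ 2)
        e′ = solve-∀
      ring : ∀ a b z → a ℕ.* (2 ℕ.* b) ℕ.* z ≡ 2 ℕ.* (a ℕ.* b) ℕ.* z
      ring = solve-∀

    3PR≤10D : 3 ℕ.* P ℕ.* R ℕ.≤ 10 ℕ.* D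
    3PR≤10D with m≤n⇒∃[o]m+o≡n P[P+4]≤x
    ... | y , refl = subst (3 ℕ.* P ℕ.* R ℕ.≤_) (sym (ring P y)) (m≤m+n _ _)
      where
      ring : ∀ P y → 10 ℕ.* ((2 ℕ.+ (P ℕ.* (P ℕ.+ 4) ℕ.+ y ℕ.+ P)) ℕ.* (1 ℕ.+ (P ℕ.* (P ℕ.+ 4) ℕ.+ y ℕ.+ P))) ≡
        3 ℕ.* P ℕ.* ((2 ℕ.* P ℕ.+ 3) ℕ.* (P ℕ.* (P ℕ.+ 4) ℕ.+ y) ℕ.+ (P ℕ.+ 2) ℕ.* (P ℕ.+ 1)) ℕ.+
        (20 ℕ.+ 30 ℕ.* y ℕ.+ 10 ℕ.* y ℕ.* y ℕ.+ 144 ℕ.* P ℕ.+ 91 ℕ.* P ℕ.* y ℕ.+ 235 ℕ.* P ℕ.* P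
          ℕ.+ 14 ℕ.* P ℕ.* P ℕ.* y ℕ.+ 64 ℕ.* P ℕ.* P ℕ.* P ℕ.+ 4 ℕ.* P ℕ.* P ℕ.* P ℕ.* P)
      ring = solve-∀

    3dPA+3dV≤ : 3 ℕ.* d ℕ.* P ℕ.* A ℕ.+ 3 ℕ.* d ℕ.* V ℕ.≤ 3 ℕ.* d ℕ.* P ℕ.* B ℕ.* xx ℕ.+ 4 ℕ.* P ℕ.* A
    3dPA+3dV≤ = begin
      3 ℕ.* d ℕ.* P ℕ.* A ℕ.+ 3 ℕ.* d ℕ.* V
        ≡⟨ cong (λ z → 3 ℕ.* d ℕ.* P ℕ.* (B ℕ.* z) ℕ.+ 3 ℕ.* d ℕ.* V) D≡xx+R ⟩
      3 ℕ.* d ℕ.* P ℕ.* (B ℕ.* (xx ℕ.+ R)) ℕ.+ 3 ℕ.* d ℕ.* V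
        ≡⟨ e₁ d P B xx R V ⟩
      3 ℕ.* d ℕ.* P ℕ.* B ℕ.* xx ℕ.+ (d ℕ.* B ℕ.* (3 ℕ.* P ℕ.* R) ℕ.+ 3 ℕ.* d ℕ.* V)
        ≤⟨ +-monoʳ-≤ (3 ℕ.* d ℕ.* P ℕ.* B ℕ.* xx) (+-mono-≤ (*-monoʳ-≤ (d ℕ.* B) 3PR≤10D) (*-monoʳ-≤ (3 ℕ.* d) V≤2BD)) ⟩
      3 ℕ.* d ℕ.* P ℕ.* B ℕ.* xx ℕ.+ (d ℕ.* B ℕ.* (10 ℕ.* D) ℕ.+ 3 ℕ.* d ℕ.* (2 ℕ.* B ℕ.* D))
        ≡⟨ cong (3 ℕ.* d ℕ.* P ℕ.* B ℕ.* xx ℕ.+_) (e₂ d B D) ⟩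
      3 ℕ.* d ℕ.* P ℕ.* B ℕ.* xx ℕ.+ 4 ℕ.* d ℕ.* 4 ℕ.* A
        ≤⟨ +-monoʳ-≤ (3 ℕ.* d ℕ.* P ℕ.* B ℕ.* xx) (*-monoˡ-≤ A (*-monoˡ-≤ 4 4d≤P)) ⟩
      3 ℕ.* d ℕ.* P ℕ.* B ℕ.* xx ℕ.+ P ℕ.* 4 ℕ.* A
        ≡⟨ cong (λ z → 3 ℕ.* d ℕ.* P ℕ.* B ℕ.* xx ℕ.+ z ℕ.* A) (*-comm P 4) ⟩
      3 ℕ.* d ℕ.* P ℕ.* B ℕ.* xx ℕ.+ 4 ℕ.* P ℕ.* A ∎
      where
      open ≤-Reasoning
      e₁ : ∀ d P B xx R w → 3 ℕ.* d ℕ.* P ℕ.* (B ℕ.* (xx ℕ.+ R)) ℕ.+ 3 ℕ.* d ℕ.* w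
                         ≡ 3 ℕ.* d ℕ.* P ℕ.* B ℕ.* xx ℕ.+ (d ℕ.* B ℕ.* (3 ℕ.* P ℕ.* R) ℕ.+ 3 ℕ.* d ℕ.* w)
      e₁ = solve-∀
      e₂ : ∀ d B z → d ℕ.* B ℕ.* (10 ℕ.* z) ℕ.+ 3 ℕ.* d ℕ.* (2 ℕ.* B ℕ.* z) ≡ 4 ℕ.* d ℕ.* 4 ℕ.* (B ℕ.* z)
      e₂ = solve-∀

    3dPA≤ : 3 ℕ.* d ℕ.* P ℕ.* A ℕ.≤ 96 ℕ.* d ℕ.* P ℕ.* e ℕ.+ 4 ℕ.* P ℕ.* A
    3dPA≤ = +-cancelʳ-≤ (3 ℕ.* d ℕ.* V) _ _ (begin
      3 ℕ.* d ℕ.* P ℕ.* A ℕ.+ 3 ℕ.* d ℕ.* V            ≤⟨ 3dPA+3dV≤ ⟩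
      3 ℕ.* d ℕ.* P ℕ.* B ℕ.* xx ℕ.+ 4 ℕ.* P ℕ.* A     ≡⟨ cong (ℕ._+ 4 ℕ.* P ℕ.* A) (e₁ d P B xx) ⟩
      3 ℕ.* d ℕ.* (P ℕ.* B ℕ.* xx) ℕ.+ 4 ℕ.* P ℕ.* A   ≤⟨ +-monoˡ-≤ (4 ℕ.* P ℕ.* A) (*-monoʳ-≤ (3 ℕ.* d) PBxx≤) ⟩
      3 ℕ.* d ℕ.* (32 ℕ.* P ℕ.* e ℕ.+ V) ℕ.+ 4 ℕ.* P ℕ.* A ≡⟨ e₂ d P e V A ⟩
      96 ℕ.* d ℕ.* P ℕ.* e ℕ.+ 4 ℕ.* P ℕ.* A ℕ.+ 3 ℕ.* d ℕ.* V ∎)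
      where
      open ≤-Reasoning
      e₁ : ∀ d P B xx → 3 ℕ.* d ℕ.* P ℕ.* B ℕ.* xx ≡ 3 ℕ.* d ℕ.* (P ℕ.* B ℕ.* xx)
      e₁ = solve-∀
      e₂ : ∀ d P e V A → 3 ℕ.* d ℕ.* (32 ℕ.* P ℕ.* e ℕ.+ V) ℕ.+ 4 ℕ.* P ℕ.* A ≡ 96 ℕ.* d ℕ.* P ℕ.* e ℕ.+ 4 ℕ.* P ℕ.* A ℕ.+ 3 ℕ.* d ℕ.* V
      e₂ = solve-∀

  lower-density : .{{_ : ℕ.NonZero P}} → 3 ℕ.* d ℕ.* (n C 4) ℕ.≤ e ℕ.* (4 ℕ.* d) ℕ.+ 4 ℕ.* (n C 4)
  lower-density = *-cancelˡ-≤ (24 ℕ.* P) {{m*n≢0 24 P}} (begin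
    24 ℕ.* P ℕ.* (3 ℕ.* d ℕ.* (n C 4))                       ≡⟨ e₁ P d (n C 4) ⟩
    3 ℕ.* d ℕ.* P ℕ.* (24 ℕ.* (n C 4))                       ≡⟨ cong (3 ℕ.* d ℕ.* P ℕ.*_) 24C≡A ⟩
    3 ℕ.* d ℕ.* P ℕ.* A                                      ≤⟨ 3dPA≤ ⟩
    96 ℕ.* d ℕ.* P ℕ.* e ℕ.+ 4 ℕ.* P ℕ.* A                   ≡⟨ cong (λ z → 96 ℕ.* d ℕ.* P ℕ.* e ℕ.+ 4 ℕ.* P ℕ.* z) (sym 24C≡A) ⟩
    96 ℕ.* d ℕ.* P ℕ.* e ℕ.+ 4 ℕ.* P ℕ.* (24 ℕ.* (n C 4))     ≡⟨ e₂ d P e (n C 4) ⟩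
    24 ℕ.* P ℕ.* (e ℕ.* (4 ℕ.* d) ℕ.+ 4 ℕ.* (n C 4))         ∎)
    where
    open ≤-Reasoning
    24C≡A : 24 ℕ.* (n C 4) ≡ A
    24C≡A = trans ([4+m]C4-formula m) (ring n (3 ℕ.+ m) (2 ℕ.+ m) (1 ℕ.+ m))
      where
      ring : ∀ a b c d → a ℕ.* b ℕ.* c ℕ.* d ≡ a ℕ.* b ℕ.* (c ℕ.* d)
      ring = solve-∀
    e₁ : ∀ P d C → 24 ℕ.* P ℕ.* (3 ℕ.* d ℕ.* C) ≡ 3 ℕ.* d ℕ.* P ℕ.* (24 ℕ.* C)
    e₁ = solve-∀
    e₂ : ∀ d P e C → 96 ℕ.* d ℕ.* P ℕ.* e ℕ.+ 4 ℕ.* P ℕ.* (24 ℕ.* C) ≡ 24 ℕ.* P ℕ.* (e ℕ.* (4 ℕ.* d) ℕ.+ 4 ℕ.* C)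
    e₂ = solve-∀

private
  ℤ-* : ∀ a b → + a ℤ.* + b ≡ + (a ℕ.* b)
  ℤ-* a b = sym (ℤP.pos-* a b)

  ℤ-+ : ∀ a b → + a ℤ.+ + b ≡ + (a ℕ.+ b)
  ℤ-+ a b = sym (ℤP.pos-+ a b)

  toℚᵘ-n/1 : (e : ℕ) → ℚ.toℚᵘ (+ e / 1) ≡ ℚᵘ.mkℚᵘ (+ e) 0
  toℚᵘ-n/1 e = cong ℚ.toℚᵘ (normalize-coprime (Coprime.sym (1-coprimeTo e)))

ℚ-upper : (e C p d-1 : ℕ) .(c : Coprime p (suc d-1)) →
  e ℕ.* (4 ℕ.* suc d-1) ℕ.≤ (3 ℕ.* suc d-1 ℕ.+ p ℕ.* 4) ℕ.* C →
  (+ e / 1) ≤ ((+ 3 / 4) + ℚ.mkℚ (+ p) d-1 c) * (+ C / 1)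
ℚ-upper e C p d-1 c h =
  toℚᵘ-cancel-≤ (ℚᵘP.≤-respʳ-≃ (ℚᵘP.≃-sym toℚᵘ-rhs) (subst (ℚᵘ._≤ _) (sym (toℚᵘ-n/1 e)) (ℚᵘ.*≤* cross)))
  where
  d = suc d-1
  toℚᵘ-rhs : ℚ.toℚᵘ (((+ 3 / 4) + ℚ.mkℚ (+ p) d-1 c) * (+ C / 1))
             ℚᵘ.≃ (ℚᵘ.mkℚᵘ (+ 3) 3 ℚᵘ.+ ℚᵘ.mkℚᵘ (+ p) d-1) ℚᵘ.* ℚᵘ.mkℚᵘ (+ C) 0
  toℚᵘ-rhs = ℚᵘP.≃-trans (toℚᵘ-homo-* ((+ 3 / 4) + ℚ.mkℚ (+ p) d-1 c) (+ C / 1))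
    (ℚᵘP.*-cong (toℚᵘ-homo-+ (+ 3 / 4) (ℚ.mkℚ (+ p) d-1 c)) (ℚᵘP.≃-reflexive (toℚᵘ-n/1 C)))
  cross : + e ℤ.* + (4 ℕ.* d ℕ.* 1) ℤ.≤ ((+ 3 ℤ.* + d ℤ.+ + p ℤ.* + 4) ℤ.* + C) ℤ.* + 1
  cross = subst₂ ℤ._≤_
    (sym (trans (ℤ-* e (4 ℕ.* d ℕ.* 1)) (cong (λ z → + (e ℕ.* z)) (*-identityʳ (4 ℕ.* d)))))
    (sym (trans (cong (ℤ._* + 1) (trans (cong (ℤ._* + C) (trans (cong₂ ℤ._+_ (ℤ-* 3 d) (ℤ-* p 4)) (ℤ-+ (3 ℕ.* d) (p ℕ.* 4))))
                                         (ℤ-* (3 ℕ.* d ℕ.+ p ℕ.* 4) C)))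
                 (trans (ℤ-* ((3 ℕ.* d ℕ.+ p ℕ.* 4) ℕ.* C) 1) (cong +_ (*-identityʳ _)))))
    (ℤ.+≤+ h)

ℚ-lower : (e C p d-1 : ℕ) .(c : Coprime p (suc d-1)) →
  3 ℕ.* suc d-1 ℕ.* C ℕ.≤ e ℕ.* (4 ℕ.* suc d-1) ℕ.+ 4 ℕ.* p ℕ.* C →
  ((+ 3 / 4) - ℚ.mkℚ (+ p) d-1 c) * (+ C / 1) ≤ (+ e / 1)
ℚ-lower e C p d-1 c h =
  toℚᵘ-cancel-≤ (ℚᵘP.≤-respˡ-≃ (ℚᵘP.≃-sym toℚᵘ-lhs) (subst (_ ℚᵘ.≤_) (sym (toℚᵘ-n/1 e)) (ℚᵘ.*≤* cross)))
  where
  d = suc d-1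
  toℚᵘ-lhs : ℚ.toℚᵘ (((+ 3 / 4) - ℚ.mkℚ (+ p) d-1 c) * (+ C / 1))
             ℚᵘ.≃ (ℚᵘ.mkℚᵘ (+ 3) 3 ℚᵘ.- ℚᵘ.mkℚᵘ (+ p) d-1) ℚᵘ.* ℚᵘ.mkℚᵘ (+ C) 0
  toℚᵘ-lhs = ℚᵘP.≃-trans (toℚᵘ-homo-* ((+ 3 / 4) - ℚ.mkℚ (+ p) d-1 c) (+ C / 1))
    (ℚᵘP.*-cong (ℚᵘP.≃-trans (toℚᵘ-homo-+ (+ 3 / 4) (ℚ.- ℚ.mkℚ (+ p) d-1 c))
                             (ℚᵘP.+-congʳ (ℚᵘ.mkℚᵘ (+ 3) 3) (toℚᵘ-homo‿- (ℚ.mkℚ (+ p) d-1 c))))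
                (ℚᵘP.≃-reflexive (toℚᵘ-n/1 C)))
  expand : ∀ (D P C : ℤ) → ((+ 3 ℤ.* D ℤ.+ (ℤ.- P) ℤ.* + 4) ℤ.* C) ℤ.* + 1 ≡ (+ 3 ℤ.* D ℤ.* C) ℤ.- (+ 4 ℤ.* P ℤ.* C)
  expand = ℤ-solve-∀
  cancel : ∀ (B C : ℤ) → (B ℤ.+ C) ℤ.- C ≡ B
  cancel = ℤ-solve-∀
  e4d = e ℕ.* (4 ℕ.* d)
  cross : ((+ 3 ℤ.* + d ℤ.+ (ℤ.- (+ p)) ℤ.* + 4) ℤ.* + C) ℤ.* + 1 ℤ.≤ + e ℤ.* + (4 ℕ.* d ℕ.* 1)
  cross = subst₂ ℤ._≤_
    (sym (trans (expand (+ d) (+ p) (+ C))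
      (cong₂ ℤ._-_ (trans (cong (ℤ._* + C) (ℤ-* 3 d)) (ℤ-* (3 ℕ.* d) C)) (trans (cong (ℤ._* + C) (ℤ-* 4 p)) (ℤ-* (4 ℕ.* p) C)))))
    (trans (cancel (+ e4d) (+ (4 ℕ.* p ℕ.* C)))
      (sym (trans (ℤ-* e (4 ℕ.* d ℕ.* 1)) (cong (λ z → + (e ℕ.* z)) (*-identityʳ (4 ℕ.* d))))))
    (ℤP.+-monoˡ-≤ (ℤ.- (+ (4 ℕ.* p ℕ.* C)))
      (subst (+ (3 ℕ.* d ℕ.* C) ℤ.≤_) (sym (ℤ-+ e4d (4 ℕ.* p ℕ.* C))) (ℤ.+≤+ h)))

n<2^n : ∀ n → n ℕ.< 2 ^ n
n<2^n zero = s≤s z≤n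
n<2^n (suc n) = ≤-trans (s≤s (n<2^n n))
  (≤-trans (≤-reflexive (+-comm 1 (2 ^ n))) (+-monoʳ-≤ (2 ^ n) (≤-trans (m^n>0 2 n) (m≤m+n (2 ^ n) 0))))

upper-bound-4+m : (p d-1 m : ℕ) .(c : Coprime (suc p) (suc d-1)) → suc d-1 ℕ.≤ m → (G : ThreeGraph (4 ℕ.+ m)) →
  (+ e42 G / 1) ≤ ((+ 3 / 4) + ℚ.mkℚ (+ suc p) d-1 c) * (+ ((4 ℕ.+ m) C 4) / 1)
upper-bound-4+m p d-1 m c d≤m G = ℚ-upper (e42 G) ((4 ℕ.+ m) C 4) (suc p) d-1 c
  (≤-trans (upper-density (suc d-1) m (e42 G) d≤m (16e42≤[n-2]²C[n,2] G))
           (*-monoˡ-≤ ((4 ℕ.+ m) C 4) (+-monoʳ-≤ (3 ℕ.* suc d-1) (m≤n*m 4 (suc p)))))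

lower-bound-4+x+P : (p d-1 : ℕ) .(c : Coprime (suc p) (suc d-1)) (x : ℕ) →
  let P = 2 ^ (4 ℕ.* suc d-1) in P ℕ.* (P ℕ.+ 4) ℕ.≤ x →
  Σ (ThreeGraph (4 ℕ.+ (x ℕ.+ P))) λ G →
    ((+ 3 / 4) - ℚ.mkℚ (+ suc p) d-1 c) * (+ ((4 ℕ.+ (x ℕ.+ P)) C 4) / 1) ≤ (+ e42 G / 1)
lower-bound-4+x+P p d-1 c x P[P+4]≤x = G , ℚ-lower (e42 G) (n C 4) (suc p) d-1 c
  (≤-trans (lower-density {{m^n≢0 2 k}}) (+-monoʳ-≤ (e42 G ℕ.* (4 ℕ.* d)) (*-monoˡ-≤ (n C 4) (m≤m*n 4 (suc p)))))
  where
  d = suc d-1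
  k = 4 ℕ.* d
  P = 2 ^ k
  n = 4 ℕ.+ (x ℕ.+ P)
  open Construction n k using (G; μ; #twins; C[n,2]μ²≤16e42+#twinsμ²; 2ᵏ·2#twins≤n[n+2ᵏ])
  μ≡x : μ ≡ x
  μ≡x = trans (cong (_∸ (P ℕ.+ 4)) (ring x P)) (m+n∸n≡m x (P ℕ.+ 4))
    where
    ring : ∀ x P → 4 ℕ.+ (x ℕ.+ P) ≡ x ℕ.+ (P ℕ.+ 4)
    ring = solve-∀
  open LowerDensity d P x (e42 G) #twins (<⇒≤ (n<2^n k)) P[P+4]≤x
    (subst (λ μ → (n C 2) ℕ.* (μ ℕ.* μ) ℕ.≤ 16 ℕ.* e42 G ℕ.+ #twins ℕ.* (μ ℕ.* μ)) μ≡x C[n,2]μ²≤16e42+#twinsμ²)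
    2ᵏ·2#twins≤n[n+2ᵏ]

upper-bound : (p d-1 : ℕ) .(c : Coprime (suc p) (suc d-1)) (n : ℕ) → suc d-1 ℕ.+ 4 ℕ.≤ n → (G : ThreeGraph n) →
  (+ e42 G / 1) ≤ ((+ 3 / 4) + ℚ.mkℚ (+ suc p) d-1 c) * (+ (n C 4) / 1)
upper-bound p d-1 c n d+4≤n =
  subst (λ n → (G : ThreeGraph n) → (+ e42 G / 1) ≤ ((+ 3 / 4) + ℚ.mkℚ (+ suc p) d-1 c) * (+ (n C 4) / 1))
    (m+[n∸m]≡n (≤-trans (m≤n+m 4 (suc d-1)) d+4≤n))
    (upper-bound-4+m p d-1 (n ∸ 4) c (subst (ℕ._≤ n ∸ 4) (m+n∸n≡m (suc d-1) 4) (∸-monoˡ-≤ 4 d+4≤n)))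

lower-bound : (p d-1 : ℕ) .(c : Coprime (suc p) (suc d-1)) (n : ℕ) →
  let P = 2 ^ (4 ℕ.* suc d-1) in P ℕ.* (P ℕ.+ 4) ℕ.+ (P ℕ.+ 4) ℕ.≤ n →
  Σ (ThreeGraph n) λ G → ((+ 3 / 4) - ℚ.mkℚ (+ suc p) d-1 c) * (+ (n C 4) / 1) ≤ (+ e42 G / 1)
lower-bound p d-1 c n bound =
  subst (λ n → Σ (ThreeGraph n) λ G → ((+ 3 / 4) - ℚ.mkℚ (+ suc p) d-1 c) * (+ (n C 4) / 1) ≤ (+ e42 G / 1))
    (trans (ring x P) (m∸n+n≡m (≤-trans (m≤n+m (P ℕ.+ 4) (P ℕ.* (P ℕ.+ 4))) bound)))
    (lower-bound-4+x+P p d-1 c x (subst (ℕ._≤ x) (m+n∸n≡m (P ℕ.* (P ℕ.+ 4)) (P ℕ.+ 4)) (∸-monoˡ-≤ (P ℕ.+ 4) bound)))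
  where
  P = 2 ^ (4 ℕ.* suc d-1)
  x = n ∸ (P ℕ.+ 4)
  ring : ∀ x P → 4 ℕ.+ (x ℕ.+ P) ≡ x ℕ.+ (P ℕ.+ 4)
  ring = solve-∀

theorem2p27 : (ε : ℚ) → 0ℚ < ε →
    Σ ℕ λ N → (n : ℕ) → n ≥ N →
      ((G : ThreeGraph n) → (+ e42 G / 1) ≤ ((+ 3 / 4) + ε) * (+ (n C 4) / 1))
      × (Σ (ThreeGraph n) λ G → ((+ 3 / 4) - ε) * (+ (n C 4) / 1) ≤ (+ e42 G / 1))
theorem2p27 (ℚ.mkℚ (+ 0) d-1 c) (ℚ.*<* (ℤ.+<+ ()))
theorem2p27 (ℚ.mkℚ ℤ.-[1+ p ] d-1 c) (ℚ.*<* ())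
theorem2p27 (ℚ.mkℚ ℤ.+[1+ p ] d-1 c) _ = N , λ n n≥N →
  upper-bound p d-1 c n (≤-trans (m≤m+n (suc d-1 ℕ.+ 4) _) n≥N) ,
  lower-bound p d-1 c n (≤-trans (m≤n+m _ (suc d-1 ℕ.+ 4)) n≥N)
  where
  P = 2 ^ (4 ℕ.* suc d-1)
  N = suc d-1 ℕ.+ 4 ℕ.+ (P ℕ.* (P ℕ.+ 4) ℕ.+ (P ℕ.+ 4))
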